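{- Let $P$ be a convex $n$-gon ($n\ge3$) with vertices $1,2,\dots,n$ in counterclockwise order, with the fan triangulation $T$ whose diagonals are $(1,3),\dots,(1,n-1)$, each oriented away from vertex $1$. Let $\lambda_{ij}$ be the initial λ-lengths of the arcs of $T$ and $\theta_i$ the initial μ-invariant of the triangle $\Delta_i=(1,i+1,i+2)$, $1\le i\le n-2$. For $3\le k\le n$, perform the super Ptolemy flips of the arcs $(1,3),(1,4),\dots,(1,k-1)$ in this order (the flip of $(1,j)$ replaces it by $(2,j+1)$); let $\lambda_{2k}$ be the resulting λ-length of $(2,k)$ and $\boxed{12k}$ the resulting μ-invariant of the triangle $(1,2,k)$ (for $k=3$ no flip is performed and $\boxed{123}=\theta_1$). Then (a) $\displaystyle\sqrt{\frac{\lambda_{2k}}{\lambda_{12}\lambda_{1k}}}\;\boxed{12k}=\sum_{i=1}^{k-2}\mathrm{wt}(\sigma_i)$; (b) $\displaystyle\lambda_{2k}=\sum_{t\in\mathcal T_{2,k}}\mathrm{wt}(t)$.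
   Context: Algebra: λ-lengths are even invertible elements with square roots, μ-invariants are odd (anticommuting, square zero); square roots are of even elements with positive body, chosen with positive body. Super Ptolemy flip: for a diagonal $e$ oriented from $P_1$ to $R$ in a quadrilateral $P_1QRS$, with triangle $P_1RS$ (μ-invariant $\theta$) to the left of $e$ and $P_1QR$ (μ-invariant $\sigma$) to the right, and $a,b,c,d$ the λ-lengths of $P_1S,SR,RQ,QP_1$: $e$ is replaced by $f=QS$ oriented $Q\to S$ with $ef=ac+bd+\sqrt{abcd}\,\sigma\theta$, triangle $QSP_1$ (left of $f$) gets $\theta'=(\theta\sqrt{bd}+\sigma\sqrt{ac})/\sqrt{ac+bd}$, triangle $QRS$ (right of $f$) gets $\sigma'=(\sigma\sqrt{bd}-\theta\sqrt{ac})/\sqrt{ac+bd}$, and the orientation of side $SR$ is reversed (other orientations unchanged). Weights: $\mathrm{wt}(\sigma_i)=\sqrt{\lambda_{i+1,i+2}/(\lambda_{1,i+1}\lambda_{1,i+2})}\;\theta_i$ (initial λ-lengths). Super $T$-paths from $2$ to $k$ (for $k\ge4$) are taken in the sub-polygon with vertices $1,\dots,k$, triangulated by $\Delta_1,\dots,\Delta_{k-2}$. Auxiliary graph: vertices $1,\dots,k$ and new vertices $\theta_1,\dots,\theta_{k-2}$ ($\theta_i$ inside $\Delta_i$); edges: the sides of $\Delta_1,\dots,\Delta_{k-2}$, the $\sigma$-edges $\sigma_i$ joining $\theta_i$ to vertex $1$, and $\tau$-edges $\tau_{ij}$ joining $\theta_i,\theta_j$ for $i<j$. The edges $(1,i+2)$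 (position $i+\frac12$, $1\le i\le k-3$) and $\sigma_i$ (position $i$) cross $(2,k)$; no others. A super $T$-path from $2$ to $k$ is $(a_0=2,\dots,a_\ell=k\mid t_1,\dots,t_\ell)$ with $t_i$ an edge joining $a_{i-1},a_i$, pairwise distinct edges, $\ell$ odd, $t_i$ crossing $(2,k)$ for even $i$, $\sigma$-edges only at even steps and $\tau$-edges only at odd steps, and crossing edges occurring in strictly increasing position. For $k=3$, $\mathcal T_{2,3}$ consists only of the single edge $(2,3)$. The weight of a path is the product of edge weights: an arc $(i,j)$ at step $s$ contributes $\lambda_{ij}$ if $s$ is odd and $\lambda_{ij}^{ -1}$ if $s$ is even, $\sigma_i$ contributes $\mathrm{wt}(\sigma_i)$, $\tau$-edges contribute $1$; odd generators are written in increasing order of index ($\theta_i$ to the left of $\theta_j$ when $i<j$). -}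

module Defs where

open import Level using (Level; _⊔_) renaming (suc to lsuc)
open import Algebra.Bundles using (Ring)
open import Data.Nat as ℕ using (ℕ; zero; suc; _∸_; _≡ᵇ_; _<ᵇ_)
open import Data.Bool using (Bool; true; false; _∧_; _∨_; not; if_then_else_)
open import Data.List using (List; []; _∷_; _++_; map; concatMap; applyUpTo; length; filter; foldr; cartesianProduct)
open import Data.Bool.ListAction using (any)
open import Data.Bool using (T?)
open import Data.Maybe using (Maybe; just; nothing)
open import Data.Product using (_×_; _,_; proj₁; proj₂)

-- Super algebra: a (not necessarily commutative) ring with
--  * predicates Even / Odd (even elements are central, odd elements
--    anticommute and square to zero),
--  * a predicate Pos ("even with positive body"), closed under +, *,
--    adding a nilpotent term y·s·t (y even, s t odd), with inverses
--    and unique Pos square roots.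
-- inv and sqrt are total functions, only specified on Pos elements.

record SuperAlgebra (c ℓ : Level) : Set (lsuc (c ⊔ ℓ)) where
  field
    ring : Ring c ℓ
  open Ring ring public
  field
    Even Odd Pos : Carrier → Set ℓ
    inv sqrt     : Carrier → Carrier
    Even-cong : ∀ {x y} → x ≈ y → Even x → Even y
    Odd-cong  : ∀ {x y} → x ≈ y → Odd x → Odd y
    Pos-cong  : ∀ {x y} → x ≈ y → Pos x → Pos y
    inv-cong  : ∀ {x y} → x ≈ y → inv x ≈ inv y
    sqrt-cong : ∀ {x y} → x ≈ y → sqrt x ≈ sqrt y
    0-even : Even 0#
    1-even : Even 1#
    +-even : ∀ {x y} → Even x → Even y → Even (x + y)
    *-even : ∀ {x y} → Even x → Even y → Even (x * y)
    neg-even : ∀ {x} → Even x → Even (- x)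
    0-odd : Odd 0#
    +-odd : ∀ {x y} → Odd x → Odd y → Odd (x + y)
    neg-odd : ∀ {x} → Odd x → Odd (- x)
    even*odd : ∀ {x y} → Even x → Odd y → Odd (x * y)
    odd*even : ∀ {x y} → Odd x → Even y → Odd (x * y)
    odd*odd : ∀ {x y} → Odd x → Odd y → Even (x * y)
    even-central : ∀ {x} → Even x → ∀ y → x * y ≈ y * x
    odd-anticomm : ∀ {x y} → Odd x → Odd y → x * y ≈ - (y * x)
    odd-square : ∀ {x} → Odd x → x * x ≈ 0#
    Pos⇒Even : ∀ {x} → Pos x → Even x
    Pos-1 : Pos 1#
    Pos-+ : ∀ {x y} → Pos x → Pos y → Pos (x + y)
    Pos-* : ∀ {x y} → Pos x → Pos y → Pos (x * y)
    Pos-nil : ∀ {x y s t} → Pos x → Even y → Odd s → Odd t → Pos (x + y * (s * t))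
    inv-inverse : ∀ {x} → Pos x → x * inv x ≈ 1#
    Pos-inv : ∀ {x} → Pos x → Pos (inv x)
    sqrt-square : ∀ {x} → Pos x → sqrt x * sqrt x ≈ x
    Pos-sqrt : ∀ {x} → Pos x → Pos (sqrt x)
    sqrt-unique : ∀ {x y} → Pos x → Pos y → y * y ≈ x → sqrt x ≈ y

-- [a .. b] (empty if b < a)
range : ℕ → ℕ → List ℕ
range a b = applyUpTo (λ i → a ℕ.+ i) (suc b ∸ a)

data Vtx : Set where
  pv : ℕ → Vtx
  tv : ℕ → Vtx      -- vertex θ_i inside Δ_i

data Edge : Set where
  arc : ℕ → ℕ → Edge   -- arc (i,j), i < j
  sig : ℕ → Edge       -- σ_i : θ_i — 1
  tau : ℕ → ℕ → Edge   -- τ_ij : θ_i — θ_j, i < j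

_==V_ : Vtx → Vtx → Bool
pv i ==V pv j = i ≡ᵇ j
tv i ==V tv j = i ≡ᵇ j
_    ==V _    = false

_==E_ : Edge → Edge → Bool
arc i j ==E arc i' j' = (i ≡ᵇ i') ∧ (j ≡ᵇ j')
sig i   ==E sig i'    = i ≡ᵇ i'
tau i j ==E tau i' j' = (i ≡ᵇ i') ∧ (j ≡ᵇ j')
_       ==E _         = false

elemE : Edge → List Edge → Bool
elemE e es = any (e ==E_) es

ends : Edge → Vtx × Vtx
ends (arc i j) = pv i , pv j
ends (sig i)   = tv i , pv 1
ends (tau i j) = tv i , tv j

-- edges of the auxiliary graph for the sub-polygon 1..k (k ≥ 4):
-- sides of Δ_1..Δ_{k-2}, σ-edges, τ-edges
edgesG : ℕ → List Edge
edgesG k = map (arc 1) (range 2 k)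
        ++ map (λ j → arc j (suc j)) (range 2 (k ∸ 1))
        ++ map sig (range 1 (k ∸ 2))
        ++ concatMap (λ i → map (tau i) (range (suc i) (k ∸ 2))) (range 1 (k ∸ 2))

verticesG : ℕ → List Vtx
verticesG k = map pv (range 1 k) ++ map tv (range 1 (k ∸ 2))

-- doubled crossing position with (2,k): (1,i+2) at i+1/2 ↦ 2i+1, σ_i at i ↦ 2i
crossPos : ℕ → Edge → Maybe ℕ
crossPos k (arc i j) =
  if (i ≡ᵇ 1) ∧ (2 <ᵇ j) ∧ (j <ᵇ k) then just (2 ℕ.* j ∸ 3) else nothing
crossPos k (sig i) =
  if (0 <ᵇ i) ∧ (i <ᵇ k ∸ 1) then just (2 ℕ.* i) else nothing
crossPos k (tau i j) = nothing

isEven : ℕ → Bool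
isEven zero = true
isEven (suc n) = not (isEven n)

isSig isTau : Edge → Bool
isSig (sig _) = true
isSig _ = false
isTau (tau _ _) = true
isTau _ = false

joins : Edge → Vtx → Vtx → Bool
joins e a b with ends e
... | u , v = ((u ==V a) ∧ (v ==V b)) ∨ ((v ==V a) ∧ (u ==V b))

-- A path is the list of steps (t_i , a_i), i = 1..ℓ, with a_0 = 2 implicit.
Step : Set
Step = Edge × Vtx

below : Maybe ℕ → ℕ → Bool
below nothing p = true
below (just q) p = q <ᵇ p

-- check k prev s lastPos used rest : the remaining steps starting at step s
checkSteps : ℕ → Vtx → ℕ → Maybe ℕ → List Edge → List Step → Bool
checkSteps k prev s lp used [] = prev ==V pv k
checkSteps k prev s lp used ((e , v) ∷ rest) =
  elemE e (edgesG k) ∧ joins e prev v ∧ not (elemE e used)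
  ∧ parityOK ∧ posOK crossPos-e
  ∧ checkSteps k v (suc s) (newLp crossPos-e) (e ∷ used) rest
  where
    crossPos-e = crossPos k e
    isCrossing : Maybe ℕ → Bool
    isCrossing (just _) = true
    isCrossing nothing = false
    parityOK : Bool
    parityOK = if isEven s then isCrossing crossPos-e ∧ not (isTau e)
                           else not (isSig e)
    posOK : Maybe ℕ → Bool
    posOK nothing = true
    posOK (just p) = below lp p
    newLp : Maybe ℕ → Maybe ℕ
    newLp nothing = lp
    newLp (just p) = just p

isSuperTPath : ℕ → List Step → Bool
isSuperTPath k p = not (isEven (length p)) ∧ checkSteps k (pv 2) 1 nothing [] p

seqs : {A : Set} → ℕ → List A → List (List A)
seqs zero xs = [] ∷ []
seqs (suc n) xs = concatMap (λ x → map (x ∷_) (seqs n xs)) xs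

-- since edges are pairwise distinct, ℓ ≤ number of edges
candidates : ℕ → List (List Step)
candidates k = concatMap (λ l → seqs l (cartesianProduct (edgesG k) (verticesG k)))
                         (range 0 (length (edgesG k)))

superTPaths : ℕ → List (List Step)
superTPaths k = if k ≡ᵇ 3 then ((arc 2 3 , pv 3) ∷ []) ∷ []
                else filter (λ p → T? (isSuperTPath k p)) (candidates k)

module Fan {c ℓ} (S : SuperAlgebra c ℓ)
           (l1 : ℕ → SuperAlgebra.Carrier S)   -- l1 j = λ_{1,j}
           (ls : ℕ → SuperAlgebra.Carrier S)   -- ls j = λ_{j,j+1}
           (th : ℕ → SuperAlgebra.Carrier S)   -- th i = θ_i
           where
  open SuperAlgebra S

  -- super Ptolemy flip: returns (f , θ' , σ')
  ptolemy : (a b c d e σ θ : Carrier) → Carrier × Carrier × Carrier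
  ptolemy a b c d e σ θ =
      inv e * (a * c + b * d + sqrt (a * b * c * d) * (σ * θ))
    , (θ * sqrt (b * d) + σ * sqrt (a * c)) * inv (sqrt (a * c + b * d))
    , (σ * sqrt (b * d) - θ * sqrt (a * c)) * inv (sqrt (a * c + b * d))

  -- state m = (λ_{2k} , [12k]) for k = m + 3, after flipping (1,3),…,(1,k-1).
  -- Flip of (1,j), j = m+3: P₁ = 1, Q = 2, R = j, S = j+1; σ = [12j],
  -- θ = θ_{j-1}; a = λ_{1,j+1}, b = λ_{j,j+1}, c = λ_{2j}, d = λ_{12}, e = λ_{1j}.
  state : ℕ → Carrier × Carrier
  state zero = ls 2 , th 1
  state (suc m) with state m
  ... | L , M with ptolemy (l1 (4 ℕ.+ m)) (ls (3 ℕ.+ m)) L (l1 2) (l1 (3 ℕ.+ m)) M (th (2 ℕ.+ m))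
  ... | f , θ' , σ' = f , θ'

  lam2 : ℕ → Carrier
  lam2 k = proj₁ (state (k ∸ 3))

  box12 : ℕ → Carrier
  box12 k = proj₂ (state (k ∸ 3))

  sumTo : ℕ → (ℕ → Carrier) → Carrier
  sumTo zero f = 0#
  sumTo (suc m) f = sumTo m f + f (suc m)

  prodTo : ℕ → (ℕ → Carrier) → Carrier
  prodTo zero f = 1#
  prodTo (suc m) f = prodTo m f * f (suc m)

  wtσ : ℕ → Carrier
  wtσ i = sqrt (ls (suc i) * inv (l1 (suc i) * l1 (2 ℕ.+ i))) * th i

  -- initial λ-length of an arc of T: (1,j) or (j,j+1)
  lamArc : ℕ → ℕ → Carrier
  lamArc i j = if i ≡ᵇ 1 then l1 j else ls i

  arcPart : ℕ → List Step → Carrier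
  arcPart s [] = 1#
  arcPart s ((arc i j , _) ∷ rest) =
    (if isEven s then inv (lamArc i j) else lamArc i j) * arcPart (suc s) rest
  arcPart s ((_ , _) ∷ rest) = arcPart (suc s) rest

  edgesOf : List Step → List Edge
  edgesOf = map proj₁

  wtPath : ℕ → List Step → Carrier
  wtPath k p = arcPart 1 p
             * prodTo (k ∸ 2) (λ i → if elemE (sig i) (edgesOf p) then wtσ i else 1#)

  sumT : ℕ → Carrier
  sumT k = foldr (λ p acc → wtPath k p + acc) 0# (superTPaths k)

module Submission where

-- Flipping (1,j) happens in the quadrilateral 1, 2, j, j+1, and the super Ptolemy relation preserves
--   λ₂ⱼ = λ₁₂λ₁ⱼ·Y   and   √(λ₂ⱼ/(λ₁₂λ₁ⱼ))·[12j] = W :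
-- the flip adds wt(σⱼ₋₁) to W, and adds to Y the ratio λⱼ,ⱼ₊₁/(λ₁ⱼλ₁,ⱼ₊₁) and the even term W·wt(σⱼ₋₁), which
-- the new W annihilates (odd elements square to zero), so that it does not disturb √Y·[12j].  This gives (a).
-- For (b), a case analysis of the crossing rules shows that the super T-paths from 2 to k are exactly
-- 2,3,1,k;  2,1,k−1,k;  2,1,j,j+1,1,k;  and 2,1,θᵢ,θₓ,1,k with i < x, whose weights are λ₁₂λ₁ₖ times the summands of Y.

open import Defs
open import Level using (Level)
open import Data.Nat using (ℕ; _≤_; _∸_; suc; s≤s)
open import Data.Product using (_×_; _,_)

module SuperAlgebraProperties {c ℓ} (S : SuperAlgebra c ℓ) where
  open SuperAlgebra S
  open import Relation.Binary.Reasoning.Setoid setoid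
  open import Algebra.Properties.Ring ring using ([y-z]x≈yx-zx)
  open import Algebra.Properties.AbelianGroup +-abelianGroup using (xyx⁻¹≈y; ⁻¹-∙-comm)

  Pos-central : ∀ {x} → Pos x → ∀ y → x * y ≈ y * x
  Pos-central p = even-central (Pos⇒Even p)

  inv-inverseˡ : ∀ {x} → Pos x → inv x * x ≈ 1#
  inv-inverseˡ {x} p = trans (Pos-central (Pos-inv p) x) (inv-inverse p)

  inv-unique : ∀ {x y} → Pos x → x * y ≈ 1# → y ≈ inv x
  inv-unique {x} {y} p xy≈1 = begin
    y                 ≈⟨ *-identityˡ y ⟨
    1# * y            ≈⟨ *-congʳ (inv-inverseˡ p) ⟨
    (inv x * x) * y   ≈⟨ *-assoc _ _ _ ⟩
    inv x * (x * y)   ≈⟨ *-congˡ xy≈1 ⟩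
    inv x * 1#        ≈⟨ *-identityʳ _ ⟩
    inv x             ∎

  *-exchange-even : ∀ {u} → Even u → ∀ x y → x * (u * y) ≈ u * (x * y)
  *-exchange-even {u} eu x y = begin
    x * (u * y) ≈⟨ *-assoc _ _ _ ⟨
    (x * u) * y ≈⟨ *-congʳ (even-central eu x) ⟨
    (u * x) * y ≈⟨ *-assoc _ _ _ ⟩
    u * (x * y) ∎

  inv-cancelˡ : ∀ {x} → Pos x → ∀ y → x * (inv x * y) ≈ y
  inv-cancelˡ {x} p y = begin
    x * (inv x * y) ≈⟨ *-assoc _ _ _ ⟨
    (x * inv x) * y ≈⟨ *-congʳ (inv-inverse p) ⟩
    1# * y          ≈⟨ *-identityˡ y ⟩
    y               ∎

  *-interchange-even : ∀ {b} → Even b → ∀ a c d → (a * b) * (c * d) ≈ (a * c) * (b * d)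
  *-interchange-even {b} eb a c d = begin
    (a * b) * (c * d) ≈⟨ *-assoc _ _ _ ⟩
    a * (b * (c * d)) ≈⟨ *-congˡ (*-assoc _ _ _) ⟨
    a * ((b * c) * d) ≈⟨ *-congˡ (*-congʳ (even-central eb c)) ⟩
    a * ((c * b) * d) ≈⟨ *-congˡ (*-assoc _ _ _) ⟩
    a * (c * (b * d)) ≈⟨ *-assoc _ _ _ ⟨
    (a * c) * (b * d) ∎

  inv-* : ∀ {x y} → Pos x → Pos y → inv (x * y) ≈ inv x * inv y
  inv-* {x} {y} px py = sym (inv-unique (Pos-* px py) (begin
    (x * y) * (inv x * inv y) ≈⟨ *-interchange-even (Pos⇒Even py) x _ _ ⟩
    (x * inv x) * (y * inv y) ≈⟨ *-cong (inv-inverse px) (inv-inverse py) ⟩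
    1# * 1#                   ≈⟨ *-identityˡ 1# ⟩
    1#                        ∎))

  *-inv-cancelʳ : ∀ {x} → Pos x → ∀ y → (x * y) * inv x ≈ y
  *-inv-cancelʳ {x} p y = begin
    (x * y) * inv x ≈⟨ *-congʳ (Pos-central p y) ⟩
    (y * x) * inv x ≈⟨ *-assoc _ _ _ ⟩
    y * (x * inv x) ≈⟨ *-congˡ (inv-inverse p) ⟩
    y * 1#          ≈⟨ *-identityʳ y ⟩
    y               ∎

  sqrt-* : ∀ {x y} → Pos x → Pos y → sqrt (x * y) ≈ sqrt x * sqrt y
  sqrt-* {x} {y} px py = sqrt-unique (Pos-* px py) (Pos-* (Pos-sqrt px) (Pos-sqrt py)) (begin
    (sqrt x * sqrt y) * (sqrt x * sqrt y) ≈⟨ *-interchange-even (Pos⇒Even (Pos-sqrt py)) _ _ _ ⟩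
    (sqrt x * sqrt x) * (sqrt y * sqrt y) ≈⟨ *-cong (sqrt-square px) (sqrt-square py) ⟩
    x * y                                 ∎)

  sqrt-*-self : ∀ {x} → Pos x → sqrt (x * x) ≈ x
  sqrt-*-self p = sqrt-unique (Pos-* p p) p refl

  difference-of-squares : ∀ {t} → Even t → ∀ s → (s - t) * (s + t) ≈ s * s - t * t
  difference-of-squares {t} et s = begin
    (s - t) * (s + t)                 ≈⟨ [y-z]x≈yx-zx _ _ _ ⟩
    s * (s + t) - t * (s + t)         ≈⟨ +-cong (distribˡ _ _ _) (-‿cong (distribˡ _ _ _)) ⟩
    (s * s + s * t) - (t * s + t * t) ≈⟨ +-congˡ (-‿cong (+-congʳ (even-central et s))) ⟩
    (s * s + s * t) - (s * t + t * t) ≈⟨ +-congˡ (⁻¹-∙-comm _ _) ⟨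
    (s * s + s * t) + (- (s * t) - t * t) ≈⟨ +-assoc _ _ _ ⟩
    s * s + (s * t + (- (s * t) - t * t)) ≈⟨ +-congˡ (+-assoc _ _ _) ⟨
    s * s + ((s * t - s * t) - t * t)     ≈⟨ +-congˡ (+-congʳ (-‿inverseʳ _)) ⟩
    s * s + (0# - t * t)                  ≈⟨ +-congˡ (+-identityˡ _) ⟩
    s * s - t * t                         ∎

  sqrt-+-annihilated : ∀ {U N V} → Pos U → Even N → Pos (U + N) → N * V ≈ 0# →
                       sqrt (U + N) * V ≈ sqrt U * V
  sqrt-+-annihilated {U} {N} {V} pU eN pUN NV≈0 = begin
      s * V                ≈⟨ *-congʳ (xyx⁻¹≈y t s) ⟨
      ((t + s) - t) * V    ≈⟨ *-congʳ (+-assoc _ _ _) ⟩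
      (t + (s - t)) * V    ≈⟨ distribʳ _ _ _ ⟩
      t * V + (s - t) * V  ≈⟨ +-congˡ difference-annihilates ⟩
      t * V + 0#           ≈⟨ +-identityʳ _ ⟩
      t * V                ∎
    where
      s t : Carrier
      s = sqrt (U + N)
      t = sqrt U
      ps+t : Pos (s + t)
      ps+t = Pos-+ (Pos-sqrt pUN) (Pos-sqrt pU)
      [s-t][s+t]≈N : (s - t) * (s + t) ≈ N
      [s-t][s+t]≈N = begin
        (s - t) * (s + t)  ≈⟨ difference-of-squares (Pos⇒Even (Pos-sqrt pU)) s ⟩
        s * s - t * t      ≈⟨ +-cong (sqrt-square pUN) (-‿cong (sqrt-square pU)) ⟩
        (U + N) - U        ≈⟨ xyx⁻¹≈y U N ⟩
        N                  ∎
      difference-annihilates : (s - t) * V ≈ 0#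
      difference-annihilates = begin
        (s - t) * V                            ≈⟨ *-congˡ (*-identityˡ V) ⟨
        (s - t) * (1# * V)                     ≈⟨ *-congˡ (*-congʳ (inv-inverse ps+t)) ⟨
        (s - t) * (((s + t) * inv (s + t)) * V) ≈⟨ *-congˡ (*-assoc _ _ _) ⟩
        (s - t) * ((s + t) * (inv (s + t) * V)) ≈⟨ *-assoc _ _ _ ⟨
        ((s - t) * (s + t)) * (inv (s + t) * V) ≈⟨ *-congʳ [s-t][s+t]≈N ⟩
        N * (inv (s + t) * V)                  ≈⟨ *-assoc _ _ _ ⟨
        (N * inv (s + t)) * V                  ≈⟨ *-congʳ (even-central eN _) ⟩
        (inv (s + t) * N) * V                  ≈⟨ *-assoc _ _ _ ⟩
        inv (s + t) * (N * V)                  ≈⟨ *-congˡ NV≈0 ⟩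
        inv (s + t) * 0#                       ≈⟨ zeroʳ _ ⟩
        0#                                     ∎

module PtolemyFlip {c ℓ} (S : SuperAlgebra c ℓ) where
  open SuperAlgebra S
  open SuperAlgebraProperties S
  open import Relation.Binary.Reasoning.Setoid setoid
  open import Algebra.Properties.Ring ring using (-‿distribʳ-*)
  open import Algebra.Properties.AbelianGroup +-abelianGroup using (ε⁻¹≈ε)

  -- In the flip of (1,j): d, e, L, M are λ₁₂, λ₁ⱼ, λ₂ⱼ, [12j] and a, b, θ are λ₁,ⱼ₊₁, λⱼ,ⱼ₊₁, θⱼ₋₁.
  record FanInvariant (d e L M Y W : Carrier) : Set ℓ where
    field
      Y-pos    : Pos Y
      M-odd    : Odd M
      L≈deY    : L ≈ (d * e) * Y
      scaled-M : sqrt (L * inv (d * e)) * M ≈ W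

  module Flip {a b d e L M θ Y W : Carrier}
              (pa : Pos a) (pb : Pos b) (pd : Pos d) (pe : Pos e) (oθ : Odd θ) (oW : Odd W)
              (I : FanInvariant d e L M Y W) where
    open FanInvariant I

    P x w Y′ L′ M′ : Carrier
    P = (d * e) * a
    x = b * inv (e * a)
    w = sqrt x * θ
    Y′ = (Y + x) + W * w
    L′ = inv e * (a * L + b * d + sqrt (a * b * L * d) * (M * θ))
    M′ = (θ * sqrt (b * d) + M * sqrt (a * L)) * inv (sqrt (a * L + b * d))

    pP : Pos P
    pP = Pos-* (Pos-* pd pe) pa
    px : Pos x
    px = Pos-* pb (Pos-inv (Pos-* pe pa))
    ow : Odd w
    ow = even*odd (Pos⇒Even (Pos-sqrt px)) oθ
    pY+x : Pos (Y + x)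
    pY+x = Pos-+ Y-pos px
    pY′ : Pos Y′
    pY′ = Pos-cong (+-congˡ (*-identityˡ _)) (Pos-nil pY+x 1-even oW ow)

    sqrtY*M≈W : sqrt Y * M ≈ W
    sqrtY*M≈W = trans (*-congʳ (sqrt-cong (sym (trans (*-congʳ L≈deY) (*-inv-cancelʳ (Pos-* pd pe) Y))))) scaled-M

    aL≈PY : a * L ≈ P * Y
    aL≈PY = begin
      a * L              ≈⟨ *-congˡ L≈deY ⟩
      a * ((d * e) * Y)  ≈⟨ *-assoc _ _ _ ⟨
      (a * (d * e)) * Y  ≈⟨ *-congʳ (Pos-central pa _) ⟩
      P * Y              ∎

    bd≈Px : b * d ≈ P * x
    bd≈Px = sym (begin
      ((d * e) * a) * (b * inv (e * a)) ≈⟨ *-congʳ (*-assoc _ _ _) ⟩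
      (d * (e * a)) * (b * inv (e * a)) ≈⟨ *-interchange-even (Pos⇒Even (Pos-* pe pa)) _ _ _ ⟩
      (d * b) * ((e * a) * inv (e * a)) ≈⟨ *-congˡ (inv-inverse (Pos-* pe pa)) ⟩
      (d * b) * 1#                      ≈⟨ *-identityʳ _ ⟩
      d * b                             ≈⟨ Pos-central pd b ⟩
      b * d                             ∎)

    aL+bd≈P[Y+x] : a * L + b * d ≈ P * (Y + x)
    aL+bd≈P[Y+x] = trans (+-cong aL≈PY bd≈Px) (sym (distribˡ _ _ _))

    sqrt-abLd : sqrt (a * b * L * d) ≈ P * (sqrt Y * sqrt x)
    sqrt-abLd = begin
      sqrt (((a * b) * L) * d)        ≈⟨ sqrt-cong (*-assoc _ _ _) ⟩
      sqrt ((a * b) * (L * d))        ≈⟨ sqrt-cong (*-interchange-even (Pos⇒Even pb) _ _ _) ⟩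
      sqrt ((a * L) * (b * d))        ≈⟨ sqrt-cong (*-cong aL≈PY bd≈Px) ⟩
      sqrt ((P * Y) * (P * x))        ≈⟨ sqrt-cong (*-interchange-even (Pos⇒Even Y-pos) _ _ _) ⟩
      sqrt ((P * P) * (Y * x))        ≈⟨ sqrt-* (Pos-* pP pP) (Pos-* Y-pos px) ⟩
      sqrt (P * P) * sqrt (Y * x)     ≈⟨ *-cong (sqrt-*-self pP) (sqrt-* Y-pos px) ⟩
      P * (sqrt Y * sqrt x)           ∎

    numerator≈PY′ : a * L + b * d + sqrt (a * b * L * d) * (M * θ) ≈ P * Y′
    numerator≈PY′ = trans (+-cong aL+bd≈P[Y+x] nilpotent-term) (sym (distribˡ _ _ _))
      where
        nilpotent-term : sqrt (a * b * L * d) * (M * θ) ≈ P * (W * w)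
        nilpotent-term = begin
          sqrt (a * b * L * d) * (M * θ)   ≈⟨ *-congʳ sqrt-abLd ⟩
          (P * (sqrt Y * sqrt x)) * (M * θ) ≈⟨ *-assoc _ _ _ ⟩
          P * ((sqrt Y * sqrt x) * (M * θ)) ≈⟨ *-congˡ (*-interchange-even (Pos⇒Even (Pos-sqrt px)) _ _ _) ⟩
          P * ((sqrt Y * M) * (sqrt x * θ)) ≈⟨ *-congˡ (*-congʳ sqrtY*M≈W) ⟩
          P * (W * w)                       ∎

    L′≈daY′ : L′ ≈ (d * a) * Y′
    L′≈daY′ = begin
      inv e * (_ + _ + _) ≈⟨ *-congˡ numerator≈PY′ ⟩
      inv e * (P * Y′)    ≈⟨ *-assoc _ _ _ ⟨
      (inv e * P) * Y′    ≈⟨ *-congʳ inv[e]*P≈da ⟩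
      (d * a) * Y′        ∎
      where
        inv[e]*P≈da : inv e * P ≈ d * a
        inv[e]*P≈da = begin
          inv e * ((d * e) * a) ≈⟨ Pos-central pP (inv e) ⟨
          ((d * e) * a) * inv e ≈⟨ *-congʳ (*-assoc _ _ _) ⟩
          (d * (e * a)) * inv e ≈⟨ *-congʳ (*-congˡ (Pos-central pe a)) ⟩
          (d * (a * e)) * inv e ≈⟨ *-congʳ (*-assoc _ _ _) ⟨
          ((d * a) * e) * inv e ≈⟨ *-assoc _ _ _ ⟩
          (d * a) * (e * inv e) ≈⟨ *-congˡ (inv-inverse pe) ⟩
          (d * a) * 1#          ≈⟨ *-identityʳ _ ⟩
          d * a                 ∎

    M′≈[w+W]/sqrt[Y+x] : M′ ≈ (w + W) * inv (sqrt (Y + x))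
    M′≈[w+W]/sqrt[Y+x] = begin
      (θ * sqrt (b * d) + M * sqrt (a * L)) * inv (sqrt (a * L + b * d))
        ≈⟨ *-cong numerator denominator ⟩
      (sqrt P * (w + W)) * (inv (sqrt P) * inv (sqrt (Y + x)))
        ≈⟨ *-congʳ (Pos-central (Pos-sqrt pP) _) ⟩
      ((w + W) * sqrt P) * (inv (sqrt P) * inv (sqrt (Y + x)))
        ≈⟨ *-assoc _ _ _ ⟩
      (w + W) * (sqrt P * (inv (sqrt P) * inv (sqrt (Y + x))))
        ≈⟨ *-congˡ (*-assoc _ _ _) ⟨
      (w + W) * ((sqrt P * inv (sqrt P)) * inv (sqrt (Y + x)))
        ≈⟨ *-congˡ (*-congʳ (inv-inverse (Pos-sqrt pP))) ⟩
      (w + W) * (1# * inv (sqrt (Y + x)))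
        ≈⟨ *-congˡ (*-identityˡ _) ⟩
      (w + W) * inv (sqrt (Y + x))  ∎
      where
        commute-root : ∀ {y} → Pos y → ∀ z → z * sqrt (P * y) ≈ sqrt P * (sqrt y * z)
        commute-root {y} py z = begin
          z * sqrt (P * y)          ≈⟨ *-congˡ (sqrt-* pP py) ⟩
          z * (sqrt P * sqrt y)     ≈⟨ Pos-central (Pos-* (Pos-sqrt pP) (Pos-sqrt py)) z ⟨
          (sqrt P * sqrt y) * z     ≈⟨ *-assoc _ _ _ ⟩
          sqrt P * (sqrt y * z)     ∎
        numerator : θ * sqrt (b * d) + M * sqrt (a * L) ≈ sqrt P * (w + W)
        numerator = begin
          θ * sqrt (b * d) + M * sqrt (a * L)     ≈⟨ +-cong (*-congˡ (sqrt-cong bd≈Px)) (*-congˡ (sqrt-cong aL≈PY)) ⟩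
          θ * sqrt (P * x) + M * sqrt (P * Y)     ≈⟨ +-cong (commute-root px θ) (commute-root Y-pos M) ⟩
          sqrt P * w + sqrt P * (sqrt Y * M)      ≈⟨ +-congˡ (*-congˡ sqrtY*M≈W) ⟩
          sqrt P * w + sqrt P * W                 ≈⟨ distribˡ _ _ _ ⟨
          sqrt P * (w + W)                        ∎
        denominator : inv (sqrt (a * L + b * d)) ≈ inv (sqrt P) * inv (sqrt (Y + x))
        denominator = trans (inv-cong (trans (sqrt-cong aL+bd≈P[Y+x]) (sqrt-* pP pY+x)))
                            (inv-* (Pos-sqrt pP) (Pos-sqrt pY+x))

    preserved : FanInvariant d a L′ M′ Y′ (W + w)
    preserved = record
      { Y-pos    = pY′
      ; M-odd    = Odd-cong (sym M′≈[w+W]/sqrt[Y+x])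
                            (odd*even (+-odd ow oW) (Pos⇒Even (Pos-inv (Pos-sqrt pY+x))))
      ; L≈deY    = L′≈daY′
      ; scaled-M = scaled-M′ }
      where
        [Ww][w+W]≈0 : (W * w) * (w + W) ≈ 0#
        [Ww][w+W]≈0 = begin
          (W * w) * (w + W)             ≈⟨ distribˡ _ _ _ ⟩
          (W * w) * w + (W * w) * W     ≈⟨ +-cong (*-assoc _ _ _) (*-assoc _ _ _) ⟩
          W * (w * w) + W * (w * W)     ≈⟨ +-cong (*-congˡ (odd-square ow)) (*-congˡ (odd-anticomm ow oW)) ⟩
          W * 0# + W * - (W * w)        ≈⟨ +-cong (zeroʳ W) (sym (-‿distribʳ-* _ _)) ⟩
          0# - W * (W * w)              ≈⟨ +-identityˡ _ ⟩
          - (W * (W * w))               ≈⟨ -‿cong (*-assoc _ _ _) ⟨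
          - ((W * W) * w)               ≈⟨ -‿cong (*-congʳ (odd-square oW)) ⟩
          - (0# * w)                    ≈⟨ -‿cong (zeroˡ w) ⟩
          - 0#                          ≈⟨ ε⁻¹≈ε ⟩
          0#                            ∎
        scaled-M′ : sqrt (L′ * inv (d * a)) * M′ ≈ W + w
        scaled-M′ = begin
          sqrt (L′ * inv (d * a)) * M′
            ≈⟨ *-cong (sqrt-cong (trans (*-congʳ L′≈daY′) (*-inv-cancelʳ (Pos-* pd pa) Y′))) M′≈[w+W]/sqrt[Y+x] ⟩
          sqrt Y′ * ((w + W) * inv (sqrt (Y + x)))   ≈⟨ *-assoc _ _ _ ⟨
          (sqrt Y′ * (w + W)) * inv (sqrt (Y + x))   ≈⟨ *-congʳ (sqrt-+-annihilated pY+x (odd*odd oW ow) pY′ [Ww][w+W]≈0) ⟩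
          (sqrt (Y + x) * (w + W)) * inv (sqrt (Y + x)) ≈⟨ *-inv-cancelʳ (Pos-sqrt pY+x) _ ⟩
          w + W                                      ≈⟨ +-comm _ _ ⟩
          W + w                                      ∎

module FlipSequence {c ℓ} (S : SuperAlgebra c ℓ) (n : ℕ) (l1 ls th : ℕ → SuperAlgebra.Carrier S)
  (pl1 : ∀ j → 2 ≤ j → j ≤ n → SuperAlgebra.Pos S (l1 j))
  (pls : ∀ j → 2 ≤ j → suc j ≤ n → SuperAlgebra.Pos S (ls j))
  (oth : ∀ i → 1 ≤ i → suc (suc i) ≤ n → SuperAlgebra.Odd S (th i)) where
  open SuperAlgebra S
  open SuperAlgebraProperties S
  open PtolemyFlip S
  open Fan S l1 ls th
  open import Data.Nat as ℕ using (zero; z≤n)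
  open import Data.Nat.Properties using (≤-trans; n≤1+n; ≤-refl)
  open import Data.Product using (_,_; proj₁; proj₂)
  import Relation.Binary.PropositionalEquality as ≡

  x : ℕ → Carrier
  x j = ls j * inv (l1 j * l1 (suc j))

  W : ℕ → Carrier
  W m = sumTo (suc m) wtσ

  Y : ℕ → Carrier
  Y zero    = x 2
  Y (suc m) = (Y m + x (3 ℕ.+ m)) + W m * wtσ (2 ℕ.+ m)

  x-pos : ∀ j → 2 ≤ j → suc j ≤ n → Pos (x j)
  x-pos j 2≤j j<n = Pos-* (pls j 2≤j j<n)
    (Pos-inv (Pos-* (pl1 j 2≤j (≤-trans (n≤1+n j) j<n)) (pl1 (suc j) (≤-trans 2≤j (n≤1+n j)) j<n)))

  wtσ-odd : ∀ i → 1 ≤ i → suc (suc i) ≤ n → Odd (wtσ i)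
  wtσ-odd i 1≤i i+2≤n = even*odd (Pos⇒Even (Pos-sqrt (x-pos (suc i) (s≤s 1≤i) i+2≤n))) (oth i 1≤i i+2≤n)

  W-odd : ∀ m → 3 ℕ.+ m ≤ n → Odd (W m)
  W-odd zero    h = +-odd 0-odd (wtσ-odd 1 (s≤s z≤n) h)
  W-odd (suc m) h = +-odd (W-odd m (≤-trans (n≤1+n _) h)) (wtσ-odd (2 ℕ.+ m) (s≤s z≤n) h)

  state-suc : ∀ m → state (suc m) ≡.≡
    (let (L , M) = state m
         (f , θ′ , _) = ptolemy (l1 (4 ℕ.+ m)) (ls (3 ℕ.+ m)) L (l1 2) (l1 (3 ℕ.+ m)) M (th (2 ℕ.+ m))
     in f , θ′)
  state-suc m with state m
  ... | L , M = ≡.refl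

  state-invariant : ∀ m → 3 ℕ.+ m ≤ n →
    FanInvariant (l1 2) (l1 (3 ℕ.+ m)) (proj₁ (state m)) (proj₂ (state m)) (Y m) (W m)
  state-invariant zero h = record
    { Y-pos    = x-pos 2 ≤-refl h
    ; M-odd    = oth 1 (s≤s z≤n) h
    ; L≈deY    = sym (trans (sym (*-assoc _ _ _)) (*-inv-cancelʳ p12*p13 (ls 2)))
    ; scaled-M = sym (+-identityˡ _) }
    where
      p12*p13 : Pos (l1 2 * l1 3)
      p12*p13 = Pos-* (pl1 2 ≤-refl (≤-trans (s≤s (s≤s z≤n)) h)) (pl1 3 (s≤s (s≤s z≤n)) h)
  state-invariant (suc m) h rewrite state-suc m =
    Flip.preserved (pl1 (4 ℕ.+ m) (s≤s (s≤s z≤n)) h) (pls (3 ℕ.+ m) (s≤s (s≤s z≤n)) h)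
                   (pl1 2 ≤-refl (≤-trans (s≤s (s≤s z≤n)) h)) (pl1 (3 ℕ.+ m) (s≤s (s≤s z≤n)) h′)
                   (oth (2 ℕ.+ m) (s≤s z≤n) h) (W-odd m h′) (state-invariant m h′)
    where
      h′ : 3 ℕ.+ m ≤ n
      h′ = ≤-trans (n≤1+n _) h

module AuxiliaryGraph where
  open import Data.Nat as ℕ using (zero; z≤n; _<_)
  open import Data.Nat.Properties using (≡ᵇ⇒≡; ≡⇒≡ᵇ; <⇒≢; +-cancelˡ-≡; ≤-trans; <⇒≤; ≤-pred; m≤m+n)
  open import Data.Bool using (true; false; T; not; _∧_)
  open import Data.Bool.Properties using (T-≡; T-∧; T-∨)
  open import Data.List using (List; []; _∷_; _++_; map; concatMap; length; cartesianProduct)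
  open import Data.List.Properties using (∷-injectiveʳ)
  open import Data.List.Membership.Propositional using (_∈_; _∉_; find)
  open import Data.List.Membership.Propositional.Properties
    using (∈-++⁻; ∈-++⁺ˡ; ∈-++⁺ʳ; ∈-map⁻; ∈-map⁺; ∈-concatMap⁻; ∈-concatMap⁺; ∈-applyUpTo⁻; ∈-applyUpTo⁺)
  open import Data.List.Relation.Unary.Any as Any using (here)
  open import Data.List.Relation.Unary.Any.Properties using (any⁺; any⁻)
  open import Data.List.Relation.Unary.Unique.Propositional using (Unique)
  import Data.List.Relation.Unary.Unique.Propositional.Properties as Unique
  open import Data.List.Relation.Unary.All using (All; []; _∷_)
  import Data.List.Relation.Unary.All as All
  import Data.List.Relation.Unary.All.Properties as All
  open import Data.List.Relation.Unary.AllPairs using ([]; _∷_)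
  import Data.List.Relation.Unary.AllPairs as AllPairs
  import Data.List.Relation.Unary.AllPairs.Properties as AllPairs
  open import Data.List.Relation.Binary.Disjoint.Propositional using (Disjoint)
  open import Data.Product using (Σ; _,_; proj₁; proj₂)
  open import Relation.Nullary using (¬_)
  open import Data.Sum using (_⊎_; inj₁; inj₂)
  open import Function.Bundles using (Equivalence)
  open import Function using (_∘_)
  open import Relation.Binary.PropositionalEquality using (_≡_; _≢_; refl; sym; trans; cong; cong₂)

  ∧-elim : ∀ {a b} → T (a ∧ b) → T a × T b
  ∧-elim = Equivalence.to T-∧

  ∧-intro : ∀ {a b} → T a → T b → T (a ∧ b)
  ∧-intro ta tb = Equivalence.from T-∧ (ta , tb)

  T⇒≡true : ∀ {b} → T b → b ≡ true
  T⇒≡true = Equivalence.to T-≡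

  ≡true⇒T : ∀ {b} → b ≡ true → T b
  ≡true⇒T = Equivalence.from T-≡

  ∧-elim⁶ : ∀ {a b c d e f} → T (a ∧ b ∧ c ∧ d ∧ e ∧ f) → T a × T b × T c × T d × T e × T f
  ∧-elim⁶ h = let (a , h) = ∧-elim h ; (b , h) = ∧-elim h ; (c , h) = ∧-elim h ; (d , h) = ∧-elim h
              in a , b , c , d , ∧-elim h

  ∧-intro⁶ : ∀ {a b c d e f} → T a → T b → T c → T d → T e → T f → T (a ∧ b ∧ c ∧ d ∧ e ∧ f)
  ∧-intro⁶ a b c d e f = ∧-intro a (∧-intro b (∧-intro c (∧-intro d (∧-intro e f))))

  not-elim : ∀ {a} → T (not a) → ¬ T a
  not-elim {true} () _

  not-intro : ∀ {a} → ¬ T a → T (not a)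
  not-intro {true}  ¬a = ¬a _
  not-intro {false} _  = _

  ==V⇒≡ : ∀ u v → T (u ==V v) → u ≡ v
  ==V⇒≡ (pv i) (pv j) h = cong pv (≡ᵇ⇒≡ i j h)
  ==V⇒≡ (tv i) (tv j) h = cong tv (≡ᵇ⇒≡ i j h)

  ==V-refl : ∀ u → T (u ==V u)
  ==V-refl (pv i) = ≡⇒≡ᵇ i i refl
  ==V-refl (tv i) = ≡⇒≡ᵇ i i refl

  ==E⇒≡ : ∀ e f → T (e ==E f) → e ≡ f
  ==E⇒≡ (arc i j) (arc i′ j′) h with ∧-elim h
  ... | hi , hj with ≡ᵇ⇒≡ i i′ hi | ≡ᵇ⇒≡ j j′ hj
  ... | refl | refl = refl
  ==E⇒≡ (sig i)   (sig i′)    h = cong sig (≡ᵇ⇒≡ i i′ h)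
  ==E⇒≡ (tau i j) (tau i′ j′) h with ∧-elim h
  ... | hi , hj with ≡ᵇ⇒≡ i i′ hi | ≡ᵇ⇒≡ j j′ hj
  ... | refl | refl = refl

  ==E-refl : ∀ e → T (e ==E e)
  ==E-refl (arc i j) = ∧-intro (≡⇒≡ᵇ i i refl) (≡⇒≡ᵇ j j refl)
  ==E-refl (sig i)   = ≡⇒≡ᵇ i i refl
  ==E-refl (tau i j) = ∧-intro (≡⇒≡ᵇ i i refl) (≡⇒≡ᵇ j j refl)

  elemE⇒∈ : ∀ {e} es → T (elemE e es) → e ∈ es
  elemE⇒∈ {e} es h = Any.map (==E⇒≡ e _) (any⁻ (e ==E_) es h)

  ∈⇒elemE : ∀ {e es} → e ∈ es → T (elemE e es)
  ∈⇒elemE {e} e∈es = any⁺ (e ==E_) (Any.map (λ { refl → ==E-refl e }) e∈es)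

  ∉-by-elemE : ∀ {e used} → T (not (elemE e used)) → e ∉ used
  ∉-by-elemE h = not-elim h ∘ ∈⇒elemE

  ∈-range⁻ : ∀ {a b v} → v ∈ range a b → a ≤ v × v ≤ b
  ∈-range⁻ {a} {b} v∈ with ∈-applyUpTo⁻ (a ℕ.+_) v∈
  ... | i , i<b+1-a , refl = m≤m+n a i , bound a b i i<b+1-a
    where
      bound : ∀ a b i → i < suc b ∸ a → a ℕ.+ i ≤ b
      bound zero          b       i h = ≤-pred h
      bound (suc a)       (suc b) i h = s≤s (bound a b i h)
      bound (suc zero)    zero    i ()
      bound (suc (suc a)) zero    i ()

  range-unique : ∀ a b → Unique (range a b)
  range-unique a b = Unique.applyUpTo⁺₁ (a ℕ.+_) (suc b ∸ a) (λ i<j _ eq → <⇒≢ i<j (+-cancelˡ-≡ a _ _ eq))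

  range-offset : ∀ a b v → a ≤ v → v ≤ b → Σ ℕ λ i → i < suc b ∸ a × v ≡ a ℕ.+ i
  range-offset zero    b       v       z≤n       v≤b       = v , s≤s v≤b , refl
  range-offset (suc a) (suc b) (suc v) (s≤s a≤v) (s≤s v≤b) with range-offset a b v a≤v v≤b
  ... | i , i< , refl = i , i< , refl

  ∈-range⁺ : ∀ {a b v} → a ≤ v → v ≤ b → v ∈ range a b
  ∈-range⁺ {a} {b} {v} a≤v v≤b with range-offset a b v a≤v v≤b
  ... | i , i< , refl = ∈-applyUpTo⁺ (a ℕ.+_) i<

  data GraphEdge (k : ℕ) : Edge → Set where
    fan  : ∀ {j} → 2 ≤ j → j ≤ k → GraphEdge k (arc 1 j)
    side : ∀ {j} → 2 ≤ j → j ≤ k ∸ 1 → GraphEdge k (arc j (suc j))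
    σ    : ∀ {i} → 1 ≤ i → i ≤ k ∸ 2 → GraphEdge k (sig i)
    τ    : ∀ {i j} → 1 ≤ i → i < j → j ≤ k ∸ 2 → GraphEdge k (tau i j)

  ∈-edgesG⁻ : ∀ k {e} → e ∈ edgesG k → GraphEdge k e
  ∈-edgesG⁻ k e∈ with ∈-++⁻ (map (arc 1) (range 2 k)) e∈
  ... | inj₁ e∈fans with ∈-map⁻ (arc 1) e∈fans
  ...   | j , j∈ , refl = let (2≤j , j≤k) = ∈-range⁻ j∈ in fan 2≤j j≤k
  ∈-edgesG⁻ k e∈ | inj₂ e∈′ with ∈-++⁻ (map (λ j → arc j (suc j)) (range 2 (k ∸ 1))) e∈′
  ... | inj₁ e∈sides with ∈-map⁻ (λ j → arc j (suc j)) e∈sides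
  ...   | j , j∈ , refl = let (2≤j , j≤k-1) = ∈-range⁻ j∈ in side 2≤j j≤k-1
  ∈-edgesG⁻ k e∈ | inj₂ e∈′ | inj₂ e∈″ with ∈-++⁻ (map sig (range 1 (k ∸ 2))) e∈″
  ... | inj₁ e∈σs with ∈-map⁻ sig e∈σs
  ...   | i , i∈ , refl = let (1≤i , i≤k-2) = ∈-range⁻ i∈ in σ 1≤i i≤k-2
  ∈-edgesG⁻ k e∈ | inj₂ e∈′ | inj₂ e∈″ | inj₂ e∈τs
    with find (∈-concatMap⁻ (λ i → map (tau i) (range (suc i) (k ∸ 2))) {xs = range 1 (k ∸ 2)} e∈τs)
  ... | i , i∈ , e∈τᵢ with ∈-map⁻ (tau i) e∈τᵢ
  ...   | j , j∈ , refl = let (i<j , j≤k-2) = ∈-range⁻ j∈ in τ (proj₁ (∈-range⁻ i∈)) i<j j≤k-2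

  ∈-edgesG⁺ : ∀ k {e} → GraphEdge k e → e ∈ edgesG k
  ∈-edgesG⁺ k (fan 2≤j j≤k) = ∈-++⁺ˡ (∈-map⁺ (arc 1) (∈-range⁺ 2≤j j≤k))
  ∈-edgesG⁺ k (side 2≤j j≤k-1) = ∈-++⁺ʳ (map (arc 1) (range 2 k))
    (∈-++⁺ˡ (∈-map⁺ (λ j → arc j (suc j)) (∈-range⁺ 2≤j j≤k-1)))
  ∈-edgesG⁺ k (σ 1≤i i≤k-2) = ∈-++⁺ʳ (map (arc 1) (range 2 k))
    (∈-++⁺ʳ (map (λ j → arc j (suc j)) (range 2 (k ∸ 1))) (∈-++⁺ˡ (∈-map⁺ sig (∈-range⁺ 1≤i i≤k-2))))
  ∈-edgesG⁺ k (τ {i} 1≤i i<j j≤k-2) = ∈-++⁺ʳ (map (arc 1) (range 2 k))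
    (∈-++⁺ʳ (map (λ j → arc j (suc j)) (range 2 (k ∸ 1))) (∈-++⁺ʳ (map sig (range 1 (k ∸ 2)))
      (∈-concatMap⁺ (λ i → map (tau i) (range (suc i) (k ∸ 2)))
        (Any.map (λ { refl → ∈-map⁺ (tau i) (∈-range⁺ i<j j≤k-2) })
                 (∈-range⁺ 1≤i (≤-trans (<⇒≤ i<j) j≤k-2))))))

  joins⇒ends : ∀ e {u v} → T (joins e u v) → ends e ≡ (u , v) ⊎ ends e ≡ (v , u)
  joins⇒ends e {u} {v} h with ends e
  ... | a , b with Equivalence.to T-∨ h
  ...   | inj₁ h′ = let (a=u , b=v) = ∧-elim h′ in inj₁ (cong₂ _,_ (==V⇒≡ a u a=u) (==V⇒≡ b v b=v))
  ...   | inj₂ h′ = let (b=u , a=v) = ∧-elim h′ in inj₂ (cong₂ _,_ (==V⇒≡ a v a=v) (==V⇒≡ b u b=u))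

  joins-forward : ∀ e → T (joins e (proj₁ (ends e)) (proj₂ (ends e)))
  joins-forward e with ends e
  ... | a , b = Equivalence.from T-∨ (inj₁ (∧-intro (==V-refl a) (==V-refl b)))

  joins-backward : ∀ e → T (joins e (proj₂ (ends e)) (proj₁ (ends e)))
  joins-backward e with ends e
  ... | a , b = Equivalence.from T-∨ (inj₂ (∧-intro (==V-refl b) (==V-refl a)))

  data Move (k : ℕ) : Vtx → Edge → Vtx → Set where
    fan-out   : ∀ {j} → 2 ≤ j → j ≤ k → Move k (pv 1) (arc 1 j) (pv j)
    fan-in    : ∀ {j} → 2 ≤ j → j ≤ k → Move k (pv j) (arc 1 j) (pv 1)
    side-up   : ∀ {j} → 2 ≤ j → j ≤ k ∸ 1 → Move k (pv j) (arc j (suc j)) (pv (suc j))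
    side-down : ∀ {j} → 2 ≤ j → j ≤ k ∸ 1 → Move k (pv (suc j)) (arc j (suc j)) (pv j)
    σ-in      : ∀ {i} → 1 ≤ i → i ≤ k ∸ 2 → Move k (pv 1) (sig i) (tv i)
    σ-out     : ∀ {i} → 1 ≤ i → i ≤ k ∸ 2 → Move k (tv i) (sig i) (pv 1)
    τ-up      : ∀ {i j} → 1 ≤ i → i < j → j ≤ k ∸ 2 → Move k (tv i) (tau i j) (tv j)
    τ-down    : ∀ {i j} → 1 ≤ i → i < j → j ≤ k ∸ 2 → Move k (tv j) (tau i j) (tv i)

  move⁺ : ∀ {k u e v} → GraphEdge k e → T (joins e u v) → Move k u e v
  move⁺ {e = e} g h with joins⇒ends e h
  move⁺ (fan  a b)   h | inj₁ refl = fan-out a b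
  move⁺ (fan  a b)   h | inj₂ refl = fan-in a b
  move⁺ (side a b)   h | inj₁ refl = side-up a b
  move⁺ (side a b)   h | inj₂ refl = side-down a b
  move⁺ (σ    a b)   h | inj₁ refl = σ-out a b
  move⁺ (σ    a b)   h | inj₂ refl = σ-in a b
  move⁺ (τ    a b c) h | inj₁ refl = τ-up a b c
  move⁺ (τ    a b c) h | inj₂ refl = τ-down a b c

  move⁻ : ∀ {k u e v} → Move k u e v → GraphEdge k e × T (joins e u v)
  move⁻ {e = e} (fan-out a b)  = fan a b , joins-forward e
  move⁻ {e = e} (fan-in a b)   = fan a b , joins-backward e
  move⁻ {e = e} (side-up a b)  = side a b , joins-forward e
  move⁻ {e = e} (side-down a b) = side a b , joins-backward e
  move⁻ {e = e} (σ-in a b)     = σ a b , joins-backward e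
  move⁻ {e = e} (σ-out a b)    = σ a b , joins-forward e
  move⁻ {e = e} (τ-up a b c)   = τ a b c , joins-forward e
  move⁻ {e = e} (τ-down a b c) = τ a b c , joins-backward e

  concatMap-unique : ∀ {A B : Set} (f : A → List B) {xs} → (∀ x → Unique (f x)) →
                     (∀ {x y} → x ≢ y → Disjoint (f x) (f y)) → Unique xs → Unique (concatMap f xs)
  concatMap-unique f {xs} f-unique f-disjoint xs-unique =
    Unique.concat⁺ (All.map⁺ (All.universal f-unique xs)) (AllPairs.map⁺ (AllPairs.map f-disjoint xs-unique))

  edgesG-unique : ∀ k → Unique (edgesG k)
  edgesG-unique k =
    Unique.++⁺ (Unique.map⁺ arc-injective₂ (range-unique 2 k))
      (Unique.++⁺ (Unique.map⁺ arc-injective₁ (range-unique 2 (k ∸ 1)))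
        (Unique.++⁺ (Unique.map⁺ (λ { refl → refl }) (range-unique 1 (k ∸ 2))) τs-unique σs∩τs≡∅)
        sides∩rest≡∅)
      fans∩rest≡∅
    where
      arc-injective₁ : ∀ {i j} → arc i (suc i) ≡ arc j (suc j) → i ≡ j
      arc-injective₁ refl = refl
      arc-injective₂ : ∀ {i j} → arc 1 i ≡ arc 1 j → i ≡ j
      arc-injective₂ refl = refl
      τs : List Edge
      τs = concatMap (λ i → map (tau i) (range (suc i) (k ∸ 2))) (range 1 (k ∸ 2))
      τs-unique : Unique τs
      τs-unique = concatMap-unique _ (λ i → Unique.map⁺ (λ { refl → refl }) (range-unique (suc i) (k ∸ 2)))
        (λ i≢j (e∈i , e∈j) → i≢j (same-source e∈i e∈j)) (range-unique 1 (k ∸ 2))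
        where
          same-source : ∀ {e i j} → e ∈ map (tau i) (range (suc i) (k ∸ 2)) →
                        e ∈ map (tau j) (range (suc j) (k ∸ 2)) → i ≡ j
          same-source e∈i e∈j with ∈-map⁻ (tau _) e∈i | ∈-map⁻ (tau _) e∈j
          ... | _ , _ , refl | _ , _ , refl = refl
      τ-shaped : ∀ {e} → e ∈ τs → T (isTau e)
      τ-shaped e∈ with i , _ , e∈τᵢ ← find (∈-concatMap⁻ (λ i → map (tau i) (range (suc i) (k ∸ 2))) {xs = range 1 (k ∸ 2)} e∈)
        with _ , _ , refl ← ∈-map⁻ (tau i) e∈τᵢ = _
      σs∩τs≡∅ : Disjoint (map sig (range 1 (k ∸ 2))) τs
      σs∩τs≡∅ (e∈σs , e∈τs) with _ , _ , refl ← ∈-map⁻ sig e∈σs with () ← τ-shaped e∈τs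
      sides∩rest≡∅ : Disjoint (map (λ j → arc j (suc j)) (range 2 (k ∸ 1))) (map sig (range 1 (k ∸ 2)) ++ τs)
      sides∩rest≡∅ (e∈sides , e∈rest) with _ , _ , refl ← ∈-map⁻ (λ j → arc j (suc j)) e∈sides
        with ∈-++⁻ (map sig (range 1 (k ∸ 2))) e∈rest
      ... | inj₁ e∈σs with _ , _ , () ← ∈-map⁻ sig e∈σs
      ... | inj₂ e∈τs with () ← τ-shaped e∈τs
      fans∩rest≡∅ : Disjoint (map (arc 1) (range 2 k))
                             (map (λ j → arc j (suc j)) (range 2 (k ∸ 1)) ++ map sig (range 1 (k ∸ 2)) ++ τs)
      fans∩rest≡∅ (e∈fans , e∈rest) with _ , _ , refl ← ∈-map⁻ (arc 1) e∈fans
        with ∈-++⁻ (map (λ j → arc j (suc j)) (range 2 (k ∸ 1))) e∈rest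
      ... | inj₁ e∈sides with _ , 1∈ , refl ← ∈-map⁻ (λ j → arc j (suc j)) e∈sides
        with s≤s () , _ ← ∈-range⁻ {b = k ∸ 1} 1∈
      ... | inj₂ e∈σs∪τs with ∈-++⁻ (map sig (range 1 (k ∸ 2))) e∈σs∪τs
      ...   | inj₁ e∈σs with _ , _ , () ← ∈-map⁻ sig e∈σs
      ...   | inj₂ e∈τs with () ← τ-shaped e∈τs

  verticesG-unique : ∀ k → Unique (verticesG k)
  verticesG-unique k = Unique.++⁺ (Unique.map⁺ (λ { refl → refl }) (range-unique 1 k))
                                  (Unique.map⁺ (λ { refl → refl }) (range-unique 1 (k ∸ 2))) pvs∩tvs≡∅
    where
      pvs∩tvs≡∅ : Disjoint (map pv (range 1 k)) (map tv (range 1 (k ∸ 2)))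
      pvs∩tvs≡∅ (u∈pvs , u∈tvs) with ∈-map⁻ pv u∈pvs | ∈-map⁻ tv u∈tvs
      ... | _ , _ , refl | _ , _ , ()

  seqs-length : ∀ {A : Set} n (xs : List A) {p} → p ∈ seqs n xs → length p ≡ n
  seqs-length zero    xs (here refl) = refl
  seqs-length (suc n) xs p∈ with x , _ , p∈ₓ ← find (∈-concatMap⁻ (λ x → map (x ∷_) (seqs n xs)) {xs = xs} p∈)
    with q , q∈ , refl ← ∈-map⁻ (x ∷_) p∈ₓ = cong suc (seqs-length n xs q∈)

  seqs-unique : ∀ {A : Set} n {xs : List A} → Unique xs → Unique (seqs n xs)
  seqs-unique zero    xs-unique = [] ∷ []
  seqs-unique (suc n) {xs} xs-unique =
    concatMap-unique (λ x → map (x ∷_) (seqs n xs)) (λ x → Unique.map⁺ ∷-injectiveʳ (seqs-unique n xs-unique))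
      (λ x≢y (p∈x , p∈y) → x≢y (same-head p∈x p∈y)) xs-unique
    where
      same-head : ∀ {p x y} → p ∈ map (x ∷_) (seqs n xs) → p ∈ map (y ∷_) (seqs n xs) → x ≡ y
      same-head p∈x p∈y with ∈-map⁻ (_ ∷_) p∈x | ∈-map⁻ (_ ∷_) p∈y
      ... | _ , _ , refl | _ , _ , refl = refl

  ∈-seqs⁺ : ∀ {A : Set} {xs : List A} {p} → All (_∈ xs) p → p ∈ seqs (length p) xs
  ∈-seqs⁺             []                = here refl
  ∈-seqs⁺ {xs = xs} {x ∷ p} (x∈ ∷ p⊆) =
    ∈-concatMap⁺ (λ y → map (y ∷_) (seqs (length p) xs)) (Any.map (λ { refl → ∈-map⁺ (x ∷_) (∈-seqs⁺ p⊆) }) x∈)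

  candidates-unique : ∀ k → Unique (candidates k)
  candidates-unique k =
    concatMap-unique (λ l → seqs l steps) (λ l → seqs-unique l (Unique.cartesianProduct⁺ (edgesG-unique k) (verticesG-unique k)))
      (λ l≢m (p∈l , p∈m) → l≢m (trans (sym (seqs-length _ steps p∈l)) (seqs-length _ steps p∈m)))
      (range-unique 0 (length (edgesG k)))
    where
      steps : List Step
      steps = cartesianProduct (edgesG k) (verticesG k)

  ∈-candidates⁺ : ∀ k {p} → length p ≤ length (edgesG k) →
                  All (_∈ cartesianProduct (edgesG k) (verticesG k)) p → p ∈ candidates k
  ∈-candidates⁺ k {p} short p⊆ =
    ∈-concatMap⁺ (λ l → seqs l (cartesianProduct (edgesG k) (verticesG k)))
                 (Any.map (λ { refl → ∈-seqs⁺ p⊆ }) (∈-range⁺ {0} z≤n short))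

module Walks where
  open AuxiliaryGraph
  open import Data.Nat as ℕ using (z≤n; _<_; _≡ᵇ_)
  open import Data.Nat.Properties using (≡ᵇ⇒≡; <ᵇ⇒<; <⇒<ᵇ; n≮n)
  open import Data.Bool using (Bool; true; false; T; not; _∧_; if_then_else_)
  open import Data.Maybe using (Maybe; just; nothing; is-just; _<∣>_)
  open import Data.List using (List; []; _∷_)
  open import Data.List.Membership.Propositional using (_∉_)
  open import Data.Product using (Σ; _,_)
  open import Relation.Nullary using (¬_; contradiction)
  open import Data.Empty using (⊥-elim)
  open import Function using (_∘_)
  open import Relation.Binary.PropositionalEquality using (_≡_; refl)

  -- The tests that checkSteps applies to each step; in Defs they are local to its definition.
  parity-ok : ℕ → Edge → Maybe ℕ → Bool
  parity-ok s e c = if isEven s then is-just c ∧ not (isTau e) else not (isSig e)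

  increasing : Maybe ℕ → Maybe ℕ → Bool
  increasing lp nothing  = true
  increasing lp (just p) = below lp p

  -- checkSteps as an inductive relation; the crossing position c of each step is an index, so that matching
  -- on it evaluates the step tests.
  data Walk (k : ℕ) : Vtx → ℕ → Maybe ℕ → List Edge → List Step → Set where
    end  : ∀ {s lp used} → Walk k (pv k) s lp used []
    step : ∀ {u e v s lp used p} c → crossPos k e ≡ c → Move k u e v → e ∉ used →
           T (parity-ok s e c) → T (increasing lp c) →
           Walk k v (suc s) (c <∣> lp) (e ∷ used) p → Walk k u s lp used ((e , v) ∷ p)

  checkSteps⇒Walk : ∀ {k u s lp used} p → T (checkSteps k u s lp used p) → Walk k u s lp used p
  checkSteps⇒Walk {k} {u} [] h with ==V⇒≡ u (pv k) h
  ... | refl = end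
  checkSteps⇒Walk {k} ((e , v) ∷ p) h with crossPos k e in eq
  ... | nothing = let (g , j , f , par , pos , rest) = ∧-elim⁶ h in
    step nothing eq (move⁺ (∈-edgesG⁻ k (elemE⇒∈ _ g)) j) (∉-by-elemE f) par pos (checkSteps⇒Walk p rest)
  ... | just q  = let (g , j , f , par , pos , rest) = ∧-elim⁶ h in
    step (just q) eq (move⁺ (∈-edgesG⁻ k (elemE⇒∈ _ g)) j) (∉-by-elemE f) par pos (checkSteps⇒Walk p rest)

  Walk⇒checkSteps : ∀ {k u s lp used p} → Walk k u s lp used p → T (checkSteps k u s lp used p)
  Walk⇒checkSteps {k} end = ==V-refl (pv k)
  Walk⇒checkSteps {k} (step {e = e} c refl mv fresh par pos w) with move⁻ mv | crossPos k e
  ... | g , j | nothing = ∧-intro⁶ (∈⇒elemE (∈-edgesG⁺ k g)) j (not-intro (fresh ∘ elemE⇒∈ _)) par pos (Walk⇒checkSteps w)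
  ... | g , j | just q  = ∧-intro⁶ (∈⇒elemE (∈-edgesG⁺ k g)) j (not-intro (fresh ∘ elemE⇒∈ _)) par pos (Walk⇒checkSteps w)

  crossPos-arc⁻ : ∀ k i j {p} → crossPos k (arc i j) ≡ just p → i ≡ 1 × 2 < j × j < k × p ≡ 2 ℕ.* j ∸ 3
  crossPos-arc⁻ k i j eq with i ≡ᵇ 1 in i=1 | 2 ℕ.<ᵇ j in 2<j | j ℕ.<ᵇ k in j<k
  crossPos-arc⁻ k i j refl | true | true | true =
    ≡ᵇ⇒≡ i 1 (≡true⇒T i=1) , <ᵇ⇒< 2 j (≡true⇒T 2<j) , <ᵇ⇒< j k (≡true⇒T j<k) , refl
  crossPos-arc⁻ k i j () | true  | true  | false
  crossPos-arc⁻ k i j () | true  | false | _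
  crossPos-arc⁻ k i j () | false | _     | _

  crossPos-fan : ∀ {k j} → 2 < j → j < k → crossPos k (arc 1 j) ≡ just (2 ℕ.* j ∸ 3)
  crossPos-fan 2<j j<k rewrite T⇒≡true (<⇒<ᵇ 2<j) | T⇒≡true (<⇒<ᵇ j<k) = refl

  crossPos-fan-last : ∀ k → crossPos k (arc 1 k) ≡ nothing
  crossPos-fan-last k with 2 ℕ.<ᵇ k | k ℕ.<ᵇ k in k<k
  ... | false | _     = refl
  ... | true  | false = refl
  ... | true  | true  = contradiction (<ᵇ⇒< k k (≡true⇒T k<k)) (n≮n k)

  crossPos-σ : ∀ {k i} → 1 ≤ i → i ≤ k ∸ 2 → 2 ≤ k → crossPos k (sig i) ≡ just (2 ℕ.* i)
  crossPos-σ {suc (suc k)} {suc i} (s≤s z≤n) i≤k (s≤s (s≤s z≤n)) rewrite T⇒≡true (<⇒<ᵇ (s≤s i≤k)) = refl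

  crossPos-σ⁻ : ∀ k i {p} → crossPos k (sig i) ≡ just p → p ≡ 2 ℕ.* i
  crossPos-σ⁻ k i eq with (0 ℕ.<ᵇ i) ∧ (i ℕ.<ᵇ k ∸ 1)
  crossPos-σ⁻ k i refl | true = refl

  even-step-crossing : ∀ s e c → isEven s ≡ true → T (parity-ok s e c) → Σ ℕ λ q → c ≡ just q
  even-step-crossing s e (just q) _    _   = q , refl
  even-step-crossing s e nothing  even par rewrite even = ⊥-elim par

  odd-step-no-σ : ∀ s i c → isEven s ≡ false → ¬ T (parity-ok s (sig i) c)
  odd-step-no-σ s i c odd par rewrite odd = par

module PathCodes where
  open AuxiliaryGraph using (∈-range⁻; ∈-range⁺; range-unique)
  open import Data.Nat as ℕ using (zero; _<_)
  open import Data.Nat.Properties using (≤-refl; ≤-trans; n≤1+n; ≤∧≢⇒<; ≤-pred; n≮n)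
  open import Data.List using (List; []; _∷_; _++_; map)
  open import Data.List.Membership.Propositional using (_∈_; _∉_)
  open import Data.List.Membership.Propositional.Properties using (∈-++⁻; ∈-++⁺ˡ; ∈-++⁺ʳ; ∈-map⁻; ∈-map⁺)
  open import Data.List.Relation.Unary.Any using (here; there)
  open import Data.List.Relation.Unary.All using ([]; _∷_)
  open import Data.List.Relation.Unary.All.Properties using (¬Any⇒All¬)
  open import Data.List.Relation.Unary.Unique.Propositional using (Unique; []; _∷_)
  import Data.List.Relation.Unary.Unique.Propositional.Properties as Unique
  open import Data.List.Relation.Binary.Disjoint.Propositional using (Disjoint)
  open import Data.Product using (_,_)
  open import Data.Sum using (inj₁; inj₂)
  open import Relation.Nullary using (yes; no)
  open import Relation.Binary.PropositionalEquality using (refl)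

  data Code : Set where
    via-23   : Code
    via-end  : ℕ → Code
    via-side : ℕ → Code
    via-τ    : ℕ → ℕ → Code

  data InnerCode (r : ℕ) : Code → Set where
    via-23   : InnerCode r via-23
    via-side : ∀ {j} → 3 ≤ j → j ≤ 2 ℕ.+ r → InnerCode r (via-side j)
    via-τ    : ∀ {i x} → 1 ≤ i → i < x → x ≤ 2 ℕ.+ r → InnerCode r (via-τ i x)

  data ValidCode (r : ℕ) : Code → Set where
    via-end : ValidCode r (via-end (3 ℕ.+ r))
    inner   : ∀ {c} → InnerCode r c → ValidCode r c

  innerCodes : ℕ → List Code
  innerCodes zero    = via-23 ∷ via-τ 1 2 ∷ []
  innerCodes (suc r) = innerCodes r ++ via-side (3 ℕ.+ r) ∷ map (λ i → via-τ i (3 ℕ.+ r)) (range 1 (2 ℕ.+ r))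

  codes : ℕ → List Code
  codes r = via-end (3 ℕ.+ r) ∷ innerCodes r

  InnerCode-suc : ∀ {r c} → InnerCode r c → InnerCode (suc r) c
  InnerCode-suc via-23              = via-23
  InnerCode-suc (via-side 3≤j j≤)   = via-side 3≤j (≤-trans j≤ (n≤1+n _))
  InnerCode-suc (via-τ 1≤i i<x x≤)  = via-τ 1≤i i<x (≤-trans x≤ (n≤1+n _))

  ∈-innerCodes⁻ : ∀ r {c} → c ∈ innerCodes r → InnerCode r c
  ∈-innerCodes⁻ zero (here refl)         = via-23
  ∈-innerCodes⁻ zero (there (here refl)) = via-τ ≤-refl ≤-refl ≤-refl
  ∈-innerCodes⁻ (suc r) c∈ with ∈-++⁻ (innerCodes r) c∈
  ... | inj₁ c∈old         = InnerCode-suc (∈-innerCodes⁻ r c∈old)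
  ... | inj₂ (here refl)   = via-side (s≤s (s≤s (s≤s ℕ.z≤n))) ≤-refl
  ... | inj₂ (there c∈new) with ∈-map⁻ (λ i → via-τ i (3 ℕ.+ r)) c∈new
  ...   | i , i∈ , refl = let (1≤i , i≤) = ∈-range⁻ i∈ in via-τ 1≤i (s≤s i≤) ≤-refl

  ∈-innerCodes⁺ : ∀ r {c} → InnerCode r c → c ∈ innerCodes r
  ∈-innerCodes⁺ zero    via-23 = here refl
  ∈-innerCodes⁺ (suc r) via-23 = ∈-++⁺ˡ (∈-innerCodes⁺ r via-23)
  ∈-innerCodes⁺ zero (via-side (s≤s (s≤s (s≤s _))) (s≤s (s≤s ())))
  ∈-innerCodes⁺ (suc r) (via-side {j} 3≤j j≤) with j ℕ.≟ 3 ℕ.+ r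
  ... | yes refl = ∈-++⁺ʳ (innerCodes r) (here refl)
  ... | no  j≢   = ∈-++⁺ˡ (∈-innerCodes⁺ r (via-side 3≤j (≤-pred (≤∧≢⇒< j≤ j≢))))
  ∈-innerCodes⁺ zero (via-τ {suc zero} {suc (suc zero)} _ _ _) = there (here refl)
  ∈-innerCodes⁺ zero (via-τ {suc zero} {suc zero} _ (s≤s ()) _)
  ∈-innerCodes⁺ zero (via-τ {suc zero} {suc (suc (suc _))} _ _ (s≤s (s≤s ())))
  ∈-innerCodes⁺ zero (via-τ {suc (suc _)} _ i<x x≤) with s≤s (s≤s ()) ← ≤-trans i<x x≤
  ∈-innerCodes⁺ (suc r) (via-τ {i} {x} 1≤i i<x x≤) with x ℕ.≟ 3 ℕ.+ r
  ... | yes refl = ∈-++⁺ʳ (innerCodes r) (there (∈-map⁺ (λ i → via-τ i (3 ℕ.+ r)) (∈-range⁺ 1≤i (≤-pred i<x))))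
  ... | no  x≢   = ∈-++⁺ˡ (∈-innerCodes⁺ r (via-τ 1≤i i<x (≤-pred (≤∧≢⇒< x≤ x≢))))
  ∈-codes⁻ : ∀ r {c} → c ∈ codes r → ValidCode r c
  ∈-codes⁻ r (here refl) = via-end
  ∈-codes⁻ r (there c∈)  = inner (∈-innerCodes⁻ r c∈)

  ∈-codes⁺ : ∀ r {c} → ValidCode r c → c ∈ codes r
  ∈-codes⁺ r via-end   = here refl
  ∈-codes⁺ r (inner c) = there (∈-innerCodes⁺ r c)

  innerCodes-unique : ∀ r → Unique (innerCodes r)
  innerCodes-unique zero    = ((λ ()) ∷ []) ∷ [] ∷ []
  innerCodes-unique (suc r) = Unique.++⁺ (innerCodes-unique r) new-unique old∩new≡∅
    where
      new-τ : List Code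
      new-τ = map (λ i → via-τ i (3 ℕ.+ r)) (range 1 (2 ℕ.+ r))
      new-unique : Unique (via-side (3 ℕ.+ r) ∷ new-τ)
      new-unique = ¬Any⇒All¬ new-τ side∉ ∷ Unique.map⁺ (λ { refl → refl }) (range-unique 1 (2 ℕ.+ r))
        where
          side∉ : via-side (3 ℕ.+ r) ∉ new-τ
          side∉ c∈ with ∈-map⁻ (λ i → via-τ i (3 ℕ.+ r)) c∈
          ... | _ , _ , ()
      old∩new≡∅ : Disjoint (innerCodes r) (via-side (3 ℕ.+ r) ∷ new-τ)
      old∩new≡∅ (c∈old , here refl) with ∈-innerCodes⁻ r c∈old
      ... | via-side _ j≤ = n≮n _ j≤
      old∩new≡∅ (c∈old , there c∈new) with ∈-map⁻ (λ i → via-τ i (3 ℕ.+ r)) c∈new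
      ... | _ , _ , refl with ∈-innerCodes⁻ r c∈old
      ...   | via-τ _ _ x≤ = n≮n _ x≤

  codes-unique : ∀ r → Unique (codes r)
  codes-unique r = ¬Any⇒All¬ (innerCodes r) end∉ ∷ innerCodes-unique r
    where
      end∉ : via-end (3 ℕ.+ r) ∉ innerCodes r
      end∉ c∈ with () ← ∈-innerCodes⁻ r c∈

module FanPaths (r : ℕ) where
  open AuxiliaryGraph
  open Walks
  open PathCodes
  open import Data.Nat as ℕ using (z≤n; _<_)
  open import Data.Nat.Properties
    using (≤-refl; ≤-trans; <⇒≤; n≤1+n; n<1+n; n≮n; <⇒≱; ≤⇒≯; <ᵇ⇒<; <⇒<ᵇ;
           *-cancelˡ-<; ∸-monoˡ-≤; ∸-monoˡ-<; *-monoʳ-≤; *-monoʳ-<)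
  open import Data.Bool using (true; false; T; T?; not)
  open import Data.Maybe using (Maybe; just; nothing)
  open import Data.List using (List; []; _∷_; _++_; map; length; cartesianProduct; applyUpTo)
  open import Data.List.Membership.Propositional using (_∈_; _∉_)
  open import Data.List.Membership.Propositional.Properties
    using (∈-++⁺ˡ; ∈-++⁺ʳ; ∈-map⁺; ∈-map⁻; ∈-cartesianProduct⁺; ∈-filter⁺; ∈-filter⁻)
  open import Data.List.Membership.Propositional.Properties.WithK using (unique∧set⇒bag)
  open import Data.List.Relation.Unary.All using (All; []; _∷_)
  open import Data.List.Relation.Unary.Any using (here; there)
  import Data.List.Relation.Unary.Unique.Propositional.Properties as Unique
  open import Data.List.Relation.Binary.Permutation.Propositional using (_↭_)
  open import Data.List.Relation.Binary.BagAndSetEquality using (∼bag⇒↭)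
  open import Data.Product using (Σ; _,_; proj₁; proj₂)
  open import Data.Sum using (_⊎_; inj₁; inj₂)
  open import Data.Empty using (⊥-elim)
  open import Function.Bundles using (mk⇔)
  open import Relation.Nullary using (contradiction)
  open import Relation.Binary.PropositionalEquality using (_≡_; refl; cong)

  k : ℕ
  k = 4 ℕ.+ r

  data ReturnTo1 (j s : ℕ) (lp : Maybe ℕ) (used : List Edge) : List Step → Set where
    return : ∀ {q rest} → crossPos k (arc 1 j) ≡ just q → arc 1 j ∉ used → T (below lp q) →
             Walk k (pv 1) (suc s) (just q) (arc 1 j ∷ used) rest →
             ReturnTo1 j s lp used ((arc 1 j , pv 1) ∷ rest)

  return-to-1 : ∀ {j s lp used e v rest} → 2 ≤ j → isEven s ≡ true →
                Walk k (pv j) s lp used ((e , v) ∷ rest) → ReturnTo1 j s lp used ((e , v) ∷ rest)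
  return-to-1 {s = s} 2≤j even (step {e = e} c eq mv fresh par pos w) with even-step-crossing s e c even par
  return-to-1 2≤j even (step c eq (fan-in _ _) fresh par pos w)      | q , refl = return eq fresh pos w
  return-to-1 2≤j even (step c eq (fan-out _ _) fresh par pos w)     | q , refl with s≤s () ← 2≤j
  return-to-1 2≤j even (step c eq (σ-in _ _) fresh par pos w)        | q , refl with s≤s () ← 2≤j
  return-to-1 2≤j even (step c eq (side-up {j} _ _) fresh par pos w) | q , refl
    with refl , _ ← crossPos-arc⁻ k j (suc j) eq with s≤s () ← 2≤j
  return-to-1 2≤j even (step c eq (side-down {j} 2≤j′ _) fresh par pos w) | q , refl
    with refl , _ ← crossPos-arc⁻ k j (suc j) eq with s≤s () ← 2≤j′

  finish : ∀ {s lp used p} → isEven s ≡ false → Walk k (pv 1) s lp used p → p ≡ (arc 1 k , pv k) ∷ []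
  finish {s} odd (step c eq (σ-in {i} _ _) fresh par pos w) = ⊥-elim (odd-step-no-σ s i c odd par)
  finish odd (step c eq (fan-out 2≤j j≤k) fresh par pos end) = refl
  finish odd (step c eq (fan-out 2≤j j≤k) fresh par pos w@(step _ _ _ _ _ _ _))
    with return _ fresh′ _ _ ← return-to-1 2≤j (cong not odd) w = contradiction (here refl) fresh′
  finish odd (step c eq (fan-in (s≤s ()) _) fresh par pos w)
  finish odd (step c eq (side-up (s≤s ()) _) fresh par pos w)
  finish odd (step c eq (side-down () _) fresh par pos w)

  decode : Code → List Step
  decode via-23       = (arc 2 3 , pv 3) ∷ (arc 1 3 , pv 1) ∷ (arc 1 k , pv k) ∷ []
  decode (via-end j)  = (arc 1 2 , pv 1) ∷ (arc 1 j , pv j) ∷ (arc j (suc j) , pv (suc j)) ∷ []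
  decode (via-side j) = (arc 1 2 , pv 1) ∷ (arc 1 j , pv j) ∷ (arc j (suc j) , pv (suc j))
                      ∷ (arc 1 (suc j) , pv 1) ∷ (arc 1 k , pv k) ∷ []
  decode (via-τ i x)  = (arc 1 2 , pv 1) ∷ (sig i , tv i) ∷ (tau i x , tv x) ∷ (sig x , pv 1) ∷ (arc 1 k , pv k) ∷ []

  DecodedPath : List Step → Set
  DecodedPath p = Σ Code λ c → ValidCode r c × p ≡ decode c

  walk-σ-out : ∀ {i y used p} → Walk k (tv y) 4 (just (2 ℕ.* i)) used p →
               i < y × p ≡ (sig y , pv 1) ∷ (arc 1 k , pv k) ∷ []
  walk-σ-out (step nothing _ _ _ () _ _)
  walk-σ-out (step (just q) () (τ-up _ _ _) _ _ _ _)
  walk-σ-out (step (just q) () (τ-down _ _ _) _ _ _ _)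
  walk-σ-out {i} {y} (step (just q) eq (σ-out _ _) _ _ pos w) with refl ← crossPos-σ⁻ k y eq =
    *-cancelˡ-< 2 i y (<ᵇ⇒< _ _ pos) , cong (_ ∷_) (finish refl w)

  walk-τ : ∀ {i used p} → Walk k (tv i) 3 (just (2 ℕ.* i)) used p →
           Σ ℕ λ x → i < x × x ≤ 2 ℕ.+ r × p ≡ (tau i x , tv x) ∷ (sig x , pv 1) ∷ (arc 1 k , pv k) ∷ []
  walk-τ {i} (step c eq (σ-out _ _) _ par _ _) = ⊥-elim (odd-step-no-σ 3 i c refl par)
  walk-τ {i} (step c refl (τ-up {j = x} _ _ x≤) _ _ _ w) with walk-σ-out {i} w
  ... | i<x , refl = x , i<x , x≤ , refl
  walk-τ {i} (step c refl (τ-down _ h<i _) _ _ _ w) with walk-σ-out {i} w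
  ... | i<h , _ = contradiction (<⇒≤ h<i) (<⇒≱ i<h)

  walk-after-side : ∀ {j lp used p} → 2 ≤ j → Walk k (pv (suc j)) 4 lp used p →
    (suc j ≡ k × p ≡ []) ⊎ (suc j < k × p ≡ (arc 1 (suc j) , pv 1) ∷ (arc 1 k , pv k) ∷ [])
  walk-after-side 2≤j end = inj₁ (refl , refl)
  walk-after-side {j} 2≤j w@(step _ _ _ _ _ _ _) with return eq _ _ w′ ← return-to-1 (≤-trans 2≤j (n≤1+n _)) refl w
    with _ , _ , j+1<k , _ ← crossPos-arc⁻ k 1 (suc j) eq | refl ← finish refl w′ = inj₂ (j+1<k , refl)

  walk-side : ∀ {j p} → 2 < j → j < k → Walk k (pv j) 3 (just (2 ℕ.* j ∸ 3)) (arc 1 j ∷ arc 1 2 ∷ []) p →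
    (j ≡ 3 ℕ.+ r × p ≡ (arc j (suc j) , pv (suc j)) ∷ [])
    ⊎ (j ≤ 2 ℕ.+ r × p ≡ (arc j (suc j) , pv (suc j)) ∷ (arc 1 (suc j) , pv 1) ∷ (arc 1 k , pv k) ∷ [])
  walk-side 2<j k<k end = contradiction k<k (n≮n k)
  walk-side 2<j j<k (step c eq (fan-in _ _) fresh _ _ _) = contradiction (here refl) fresh
  walk-side 2<j j<k (step c eq (fan-out _ _) _ _ _ _) with s≤s () ← 2<j
  walk-side 2<j j<k (step c eq (σ-in _ _) _ _ _ _) with s≤s () ← 2<j
  walk-side {j} 2<j j<k (step (just q) eq (side-up _ _) _ _ _ _) with refl , _ ← crossPos-arc⁻ k j (suc j) eq
    with s≤s () ← 2<j
  walk-side 2<j j<k (step nothing eq (side-up 2≤j _) _ _ _ w) with walk-after-side 2≤j w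
  ... | inj₁ (refl , refl) = inj₁ (refl , refl)
  ... | inj₂ (s≤s (s≤s j≤) , refl) = inj₂ (j≤ , refl)
  walk-side 2<j j<k (step (just q) eq (side-down {j} 2≤j _) _ _ _ _) with refl , _ ← crossPos-arc⁻ k j (suc j) eq
    with s≤s () ← 2≤j
  walk-side 2<j j<k (step nothing eq (side-down 2≤j _) _ _ _ end) = contradiction (≤-trans (n≤1+n _) j<k) (n≮n k)
  -- From j−1 the walk must return to 1 across (1, j−1), whose position lies below that of (1, j).
  walk-side 2<j j<k (step nothing eq (side-down {j} 2≤j _) _ _ _ w@(step _ _ _ _ _ _ _))
    with return eq′ _ pos _ ← return-to-1 2≤j refl w with _ , _ , _ , refl ← crossPos-arc⁻ k 1 j eq′ =
    contradiction (<ᵇ⇒< (2 ℕ.* suc j ∸ 3) (2 ℕ.* j ∸ 3) pos) (≤⇒≯ (∸-monoˡ-≤ 3 (*-monoʳ-≤ 2 (n≤1+n j))))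

  walk-from-1 : ∀ {p} → Walk k (pv 1) 2 nothing (arc 1 2 ∷ []) p → DecodedPath ((arc 1 2 , pv 1) ∷ p)
  walk-from-1 (step {e = e} c eq mv _ par _ w) with even-step-crossing 2 e c refl par
  walk-from-1 (step c eq (fan-out {j} _ _) _ _ _ w) | q , refl
    with _ , 2<j , j<k , refl ← crossPos-arc⁻ k 1 j eq with walk-side 2<j j<k w
  ... | inj₁ (refl , refl) = via-end (3 ℕ.+ r) , via-end , refl
  ... | inj₂ (j≤ , refl)   = via-side j , inner (via-side 2<j j≤) , refl
  walk-from-1 (step c eq (σ-in {i} 1≤i _) _ _ _ w) | q , refl
    with refl ← crossPos-σ⁻ k i eq with x , i<x , x≤ , refl ← walk-τ w = via-τ i x , inner (via-τ 1≤i i<x x≤) , refl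
  walk-from-1 (step c eq (fan-in (s≤s ()) _) _ _ _ w)   | q , refl
  walk-from-1 (step c eq (side-up (s≤s ()) _) _ _ _ w)  | q , refl
  walk-from-1 (step c eq (side-down () _) _ _ _ w)      | q , refl

  walk-from-3 : ∀ {p} → Walk k (pv 3) 2 nothing (arc 2 3 ∷ []) p → p ≡ (arc 1 3 , pv 1) ∷ (arc 1 k , pv k) ∷ []
  walk-from-3 w@(step _ _ _ _ _ _ _) with return _ _ _ w′ ← return-to-1 (s≤s (s≤s z≤n)) refl w
    with refl ← finish refl w′ = refl

  classify : ∀ {p} → Walk k (pv 2) 1 nothing [] p → DecodedPath p
  classify (step c refl (fan-in _ _) _ _ _ w) = walk-from-1 w
  classify (step c refl (side-up _ _) _ _ _ w) with refl ← walk-from-3 w = via-23 , inner via-23 , refl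
  classify (step c eq (side-down (s≤s ()) _) _ _ _ _)

  2≤k : 2 ≤ k
  2≤k = s≤s (s≤s z≤n)

  -- Freshness of an edge is decided by evaluating elemE whenever the indices allow it.
  walk-via-23 : Walk k (pv 2) 1 nothing [] (decode via-23)
  walk-via-23 =
    step nothing refl (side-up ≤-refl (s≤s (s≤s z≤n))) (∉-by-elemE _) _ _
    (step (just 3) refl (fan-in (s≤s (s≤s z≤n)) (s≤s (s≤s (s≤s z≤n)))) (∉-by-elemE _) _ _
    (step nothing (crossPos-fan-last k) (fan-out 2≤k ≤-refl) (∉-by-elemE _) _ _ end))

  walk-via-end : Walk k (pv 2) 1 nothing [] (decode (via-end (3 ℕ.+ r)))
  walk-via-end =
    step nothing refl (fan-in ≤-refl 2≤k) (∉-by-elemE _) _ _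
    (step (just _) (crossPos-fan (s≤s (s≤s (s≤s z≤n))) ≤-refl) (fan-out (s≤s (s≤s z≤n)) (n≤1+n _)) (∉-by-elemE _) _ _
    (step nothing refl (side-up (s≤s (s≤s z≤n)) ≤-refl) (∉-by-elemE _) _ _ end))

  walk-via-side : ∀ {j} → 3 ≤ j → j ≤ 2 ℕ.+ r → Walk k (pv 2) 1 nothing [] (decode (via-side j))
  walk-via-side {j@(suc (suc (suc t)))} (s≤s (s≤s (s≤s z≤n))) j≤ =
    step nothing refl (fan-in ≤-refl 2≤k) (∉-by-elemE _) _ _
    (step (just _) (crossPos-fan 2<j j<k) (fan-out 2≤j (<⇒≤ j<k)) (∉-by-elemE _) _ _
    (step nothing refl (side-up 2≤j (≤-trans j≤ (n≤1+n _))) (∉-by-elemE _) _ _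
    (step (just _) (crossPos-fan (≤-trans 2<j (n≤1+n _)) j+1<k) (fan-in (≤-trans 2≤j (n≤1+n _)) (<⇒≤ j+1<k))
          fresh₄ _ (<⇒<ᵇ (∸-monoˡ-< (*-monoʳ-< 2 (n<1+n j)) (s≤s (s≤s (s≤s z≤n)))))
    (step nothing (crossPos-fan-last k) (fan-out 2≤k ≤-refl) fresh₅ _ _ end))))
    where
      2≤j : 2 ≤ j
      2≤j = s≤s (s≤s z≤n)
      2<j : 2 < j
      2<j = s≤s (s≤s (s≤s z≤n))
      j+1<k : suc j < k
      j+1<k = s≤s (s≤s j≤)
      j<k : j < k
      j<k = ≤-trans (n≤1+n _) j+1<k
      fresh₄ : arc 1 (suc j) ∉ arc j (suc j) ∷ arc 1 j ∷ arc 1 2 ∷ []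
      fresh₄ (there (here ()))
      fresh₄ (there (there (here ())))
      fresh₅ : arc 1 k ∉ arc 1 (suc j) ∷ arc j (suc j) ∷ arc 1 j ∷ arc 1 2 ∷ []
      fresh₅ (here refl)                 = n≮n _ j+1<k
      fresh₅ (there (there (here refl))) = n≮n _ j<k
      fresh₅ (there (there (there (here ()))))

  walk-via-τ : ∀ {i x} → 1 ≤ i → i < x → x ≤ 2 ℕ.+ r → Walk k (pv 2) 1 nothing [] (decode (via-τ i x))
  walk-via-τ {i} {x} 1≤i i<x x≤ =
    step nothing refl (fan-in ≤-refl 2≤k) (∉-by-elemE _) _ _
    (step (just _) (crossPos-σ 1≤i i≤ 2≤k) (σ-in 1≤i i≤) (∉-by-elemE _) _ _
    (step nothing refl (τ-up 1≤i i<x x≤) (∉-by-elemE _) _ _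
    (step (just _) (crossPos-σ 1≤x x≤ 2≤k) (σ-out 1≤x x≤) fresh₄ _ (<⇒<ᵇ (*-monoʳ-< 2 i<x))
    (step nothing (crossPos-fan-last k) (fan-out 2≤k ≤-refl) (∉-by-elemE _) _ _ end))))
    where
      i≤ : i ≤ 2 ℕ.+ r
      i≤ = ≤-trans (<⇒≤ i<x) x≤
      1≤x : 1 ≤ x
      1≤x = ≤-trans 1≤i (<⇒≤ i<x)
      fresh₄ : sig x ∉ tau i x ∷ sig i ∷ arc 1 2 ∷ []
      fresh₄ (there (here refl)) = n≮n _ i<x
      fresh₄ (there (there (here ())))

  decode-walk : ∀ {c} → ValidCode r c → Walk k (pv 2) 1 nothing [] (decode c)
  decode-walk via-end                    = walk-via-end
  decode-walk (inner via-23)             = walk-via-23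
  decode-walk (inner (via-side 3≤j j≤))  = walk-via-side 3≤j j≤
  decode-walk (inner (via-τ 1≤i i<x x≤)) = walk-via-τ 1≤i i<x x≤

  pv∈ : ∀ {j} → 1 ≤ j → j ≤ k → pv j ∈ verticesG k
  pv∈ 1≤j j≤k = ∈-++⁺ˡ (∈-map⁺ pv (∈-range⁺ 1≤j j≤k))

  tv∈ : ∀ {i} → 1 ≤ i → i ≤ 2 ℕ.+ r → tv i ∈ verticesG k
  tv∈ 1≤i i≤ = ∈-++⁺ʳ (map pv (range 1 k)) (∈-map⁺ tv (∈-range⁺ 1≤i i≤))

  move-target : ∀ {u e v} → Move k u e v → v ∈ verticesG k
  move-target (fan-out 2≤j j≤k)   = pv∈ (≤-trans (s≤s z≤n) 2≤j) j≤k
  move-target (fan-in _ _)        = pv∈ ≤-refl (s≤s z≤n)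
  move-target (side-up _ j≤)      = pv∈ (s≤s z≤n) (s≤s j≤)
  move-target (side-down 2≤j j≤)  = pv∈ (≤-trans (s≤s z≤n) 2≤j) (≤-trans j≤ (n≤1+n _))
  move-target (σ-in 1≤i i≤)       = tv∈ 1≤i i≤
  move-target (σ-out _ _)         = pv∈ ≤-refl (s≤s z≤n)
  move-target (τ-up 1≤i i<j j≤)   = tv∈ (≤-trans 1≤i (<⇒≤ i<j)) j≤
  move-target (τ-down 1≤i i<j j≤) = tv∈ 1≤i (≤-trans (<⇒≤ i<j) j≤)

  walk-in-graph : ∀ {u s lp used p} → Walk k u s lp used p → All (_∈ cartesianProduct (edgesG k) (verticesG k)) p
  walk-in-graph end = []
  walk-in-graph (step _ _ mv _ _ _ w) =
    ∈-cartesianProduct⁺ (∈-edgesG⁺ k (proj₁ (move⁻ mv))) (move-target mv) ∷ walk-in-graph w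

  5≤edges : 5 ≤ length (edgesG k)
  5≤edges = s≤s (s≤s (s≤s (2≤ (map (arc 1) (applyUpTo (5 ℕ.+_) r)) _ _ _)))
    where
      2≤ : ∀ {A : Set} (xs : List A) y z ys → 2 ≤ length (xs ++ y ∷ z ∷ ys)
      2≤ []       y z ys = s≤s (s≤s z≤n)
      2≤ (x ∷ xs) y z ys = ≤-trans (2≤ xs y z ys) (n≤1+n _)

  decode-injective : ∀ {c c′} → decode c ≡ decode c′ → c ≡ c′
  decode-injective {via-23}     {via-23}     refl = refl
  decode-injective {via-end _}  {via-end _}  refl = refl
  decode-injective {via-side _} {via-side _} refl = refl
  decode-injective {via-τ _ _}  {via-τ _ _}  refl = refl
  decode-injective {via-23}     {via-end _}  ()
  decode-injective {via-23}     {via-side _} ()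
  decode-injective {via-23}     {via-τ _ _}  ()
  decode-injective {via-end _}  {via-23}     ()
  decode-injective {via-end _}  {via-side _} ()
  decode-injective {via-end _}  {via-τ _ _}  ()
  decode-injective {via-side _} {via-23}     ()
  decode-injective {via-side _} {via-end _}  ()
  decode-injective {via-side _} {via-τ _ _}  ()
  decode-injective {via-τ _ _}  {via-23}     ()
  decode-injective {via-τ _ _}  {via-end _}  ()
  decode-injective {via-τ _ _}  {via-side _} ()

  decode-length : ∀ c → length (decode c) ≤ 5
  decode-length via-23       = s≤s (s≤s (s≤s z≤n))
  decode-length (via-end _)  = s≤s (s≤s (s≤s z≤n))
  decode-length (via-side _) = ≤-refl
  decode-length (via-τ _ _)  = ≤-refl

  ∈-superTPaths⁻ : ∀ {p} → p ∈ superTPaths k → p ∈ map decode (codes r)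
  ∈-superTPaths⁻ {p} p∈ with _ , is-path ← ∈-filter⁻ (λ p → T? (isSuperTPath k p)) {xs = candidates k} p∈
    with c , valid , refl ← classify (checkSteps⇒Walk p (proj₂ (∧-elim is-path))) = ∈-map⁺ decode (∈-codes⁺ r valid)

  ∈-superTPaths⁺ : ∀ {p} → p ∈ map decode (codes r) → p ∈ superTPaths k
  ∈-superTPaths⁺ p∈ with c , c∈ , refl ← ∈-map⁻ decode p∈ =
    ∈-filter⁺ (λ p → T? (isSuperTPath k p)) {xs = candidates k}
      (∈-candidates⁺ k (≤-trans (decode-length c) 5≤edges) (walk-in-graph w)) (∧-intro (odd-length c) (Walk⇒checkSteps w))
    where
      w = decode-walk (∈-codes⁻ r c∈)
      odd-length : ∀ c → T (not (isEven (length (decode c))))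
      odd-length via-23       = _
      odd-length (via-end _)  = _
      odd-length (via-side _) = _
      odd-length (via-τ _ _)  = _

  superTPaths↭decoded : superTPaths k ↭ map decode (codes r)
  superTPaths↭decoded = ∼bag⇒↭ (unique∧set⇒bag
    (Unique.filter⁺ (λ p → T? (isSuperTPath k p)) (candidates-unique k))
    (Unique.map⁺ decode-injective (codes-unique r))
    (mk⇔ ∈-superTPaths⁻ ∈-superTPaths⁺))

module Sums {c ℓ} (S : SuperAlgebra c ℓ) where
  open SuperAlgebra S
  open import Data.List using (List; []; _∷_; _++_; map; foldr)
  open import Data.List.Properties using (foldr-map)
  open import Data.List.Membership.Propositional using (_∈_)
  open import Data.List.Relation.Unary.Any using (here; there)
  open import Data.List.Relation.Binary.Permutation.Propositional using (_↭_; ↭⇒↭ₛ′)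
  import Data.List.Relation.Binary.Permutation.Propositional.Properties as Perm
  open import Data.List.Relation.Binary.Permutation.Setoid.Properties setoid using (foldr-commMonoid)
  import Relation.Binary.PropositionalEquality as ≡
  open import Function using (_∘_)
  open import Relation.Binary.Reasoning.Setoid setoid

  sumOver : ∀ {A : Set} → (A → Carrier) → List A → Carrier
  sumOver w = foldr (λ a acc → w a + acc) 0#

  sumOver-↭ : ∀ {A : Set} (w : A → Carrier) {xs ys} → xs ↭ ys → sumOver w xs ≈ sumOver w ys
  sumOver-↭ w {xs} {ys} xs↭ys = begin
    sumOver w xs            ≡⟨ foldr-map _+_ w 0# xs ⟨
    foldr _+_ 0# (map w xs) ≈⟨ foldr-commMonoid +-isCommutativeMonoid (↭⇒↭ₛ′ isEquivalence (Perm.map⁺ w xs↭ys)) ⟩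
    foldr _+_ 0# (map w ys) ≡⟨ foldr-map _+_ w 0# ys ⟩
    sumOver w ys            ∎

  sumOver-map : ∀ {A B : Set} (w : B → Carrier) (f : A → B) xs → sumOver w (map f xs) ≡.≡ sumOver (λ a → w (f a)) xs
  sumOver-map w f = foldr-map (λ b acc → w b + acc) f 0#

  sumOver-++ : ∀ {A : Set} (w : A → Carrier) xs ys → sumOver w (xs ++ ys) ≈ sumOver w xs + sumOver w ys
  sumOver-++ w []       ys = sym (+-identityˡ _)
  sumOver-++ w (x ∷ xs) ys = trans (+-congˡ (sumOver-++ w xs ys)) (sym (+-assoc _ _ _))

  sumOver-cong : ∀ {A : Set} {v w : A → Carrier} xs → (∀ {a} → a ∈ xs → v a ≈ w a) → sumOver v xs ≈ sumOver w xs
  sumOver-cong []       v≈w = refl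
  sumOver-cong (x ∷ xs) v≈w = +-cong (v≈w (here ≡.refl)) (sumOver-cong xs (v≈w ∘ there))

  sumOver-*ˡ : ∀ {A : Set} q (w : A → Carrier) xs → sumOver (λ a → q * w a) xs ≈ q * sumOver w xs
  sumOver-*ˡ q w []       = sym (zeroʳ q)
  sumOver-*ˡ q w (x ∷ xs) = trans (+-congˡ (sumOver-*ˡ q w xs)) (sym (distribˡ _ _ _))

  sumOver-*ʳ : ∀ {A : Set} (w : A → Carrier) q xs → sumOver (λ a → w a * q) xs ≈ sumOver w xs * q
  sumOver-*ʳ w q []       = sym (zeroˡ q)
  sumOver-*ʳ w q (x ∷ xs) = trans (+-congˡ (sumOver-*ʳ w q xs)) (sym (distribʳ _ _ _))

module PathWeights {c ℓ} (S : SuperAlgebra c ℓ) (n : ℕ) (l1 ls th : ℕ → SuperAlgebra.Carrier S)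
  (pl1 : ∀ j → 2 ≤ j → j ≤ n → SuperAlgebra.Pos S (l1 j))
  (pls : ∀ j → 2 ≤ j → suc j ≤ n → SuperAlgebra.Pos S (ls j))
  (oth : ∀ i → 1 ≤ i → suc (suc i) ≤ n → SuperAlgebra.Odd S (th i)) where
  open SuperAlgebra S
  open SuperAlgebraProperties S
  open Fan S l1 ls th
  open PtolemyFlip S using (FanInvariant)
  open FlipSequence S n l1 ls th pl1 pls oth using (x; W; Y; state-invariant)
  open Sums S
  open PathCodes
  open AuxiliaryGraph using (T⇒≡true; ≡true⇒T)
  open import Data.Bool using (true; false; _∨_; if_then_else_)
  open import Relation.Nullary using (contradiction)
  open import Relation.Binary.Reasoning.Setoid setoid
  open import Algebra.Properties.CommutativeSemigroup +-commutativeSemigroup using (x∙yz≈yx∙z)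
  open import Data.Nat as ℕ using (zero; z≤n; _<_; _≡ᵇ_)
  open import Data.Nat.Properties using (≡ᵇ⇒≡; ≡⇒≡ᵇ; ≤-refl; ≤-trans; ≤-pred; n≤1+n; ≤∧≢⇒<; <⇒≢; <-trans; _≟_)
  open import Data.List using (List; _∷_; []; _++_; map; applyUpTo)
  open import Data.List.Properties using (applyUpTo-∷ʳ)
  open import Relation.Nullary using (yes; no)
  import Relation.Binary.PropositionalEquality as ≡
  open ≡ using (_≢_)
  open import Function using (_∘_)

  sumOver-range : ∀ (f : ℕ → Carrier) m → sumOver f (range 1 m) ≈ sumTo m f
  sumOver-range f zero    = refl
  sumOver-range f (suc m) = begin
    sumOver f (applyUpTo suc (suc m))       ≡⟨ ≡.cong (sumOver f) (applyUpTo-∷ʳ suc m) ⟨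
    sumOver f (range 1 m ++ suc m ∷ [])     ≈⟨ sumOver-++ f (range 1 m) _ ⟩
    sumOver f (range 1 m) + (f (suc m) + 0#) ≈⟨ +-cong (sumOver-range f m) (+-identityʳ _) ⟩
    sumTo m f + f (suc m)                   ∎

  prodTo-flat : ∀ (f : ℕ → Carrier) {a m} → a ≤ m → (∀ y → a < y → y ≤ m → f y ≈ 1#) → prodTo m f ≈ prodTo a f
  prodTo-flat f {m = zero} z≤n ones = refl
  prodTo-flat f {a} {suc m} a≤ ones with a ≟ suc m
  ... | yes ≡.refl = refl
  ... | no  a≢     = begin
    prodTo m f * f (suc m) ≈⟨ *-congˡ (ones (suc m) a< ≤-refl) ⟩
    prodTo m f * 1#        ≈⟨ *-identityʳ _ ⟩
    prodTo m f             ≈⟨ prodTo-flat f (≤-pred a<) (λ y a<y y≤m → ones y a<y (≤-trans y≤m (n≤1+n m))) ⟩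
    prodTo a f             ∎
    where
      a< : a < suc m
      a< = ≤∧≢⇒< a≤ a≢

  prodTo-pair : ∀ (f : ℕ → Carrier) {i y m} → 1 ≤ i → i < y → y ≤ m →
                (∀ z → z ≢ i → z ≢ y → f z ≈ 1#) → prodTo m f ≈ f i * f y
  prodTo-pair f {suc i} {suc y} {m} (s≤s z≤n) (s≤s i<y) y≤m ones = begin
    prodTo m f                            ≈⟨ prodTo-flat f y≤m (λ z y<z _ → ones z (<⇒≢ (<-trans (s≤s i<y) y<z) ∘ ≡.sym) (<⇒≢ y<z ∘ ≡.sym)) ⟩
    prodTo y f * f (suc y)                ≈⟨ *-congʳ (prodTo-flat f i<y (λ z i<z z≤y → ones z (<⇒≢ i<z ∘ ≡.sym) (<⇒≢ (s≤s z≤y)))) ⟩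
    (prodTo i f * f (suc i)) * f (suc y)  ≈⟨ *-congʳ (*-congʳ (prodTo-flat f z≤n (λ z _ z≤i → ones z (<⇒≢ (s≤s z≤i)) (<⇒≢ (<-trans (s≤s z≤i) (s≤s i<y)))))) ⟩
    (1# * f (suc i)) * f (suc y)          ≈⟨ *-congʳ (*-identityˡ _) ⟩
    f (suc i) * f (suc y)                 ∎

  value : Code → Carrier
  value via-23       = x 2
  value (via-end j)  = x j
  value (via-side j) = x j
  value (via-τ i y)  = wtσ i * wtσ y

  innerCodes-value : ∀ r → x (3 ℕ.+ r) + sumOver value (innerCodes r) ≈ Y (suc r)
  innerCodes-value zero = begin
    x 3 + (x 2 + (wtσ 1 * wtσ 2 + 0#)) ≈⟨ +-congˡ (+-congˡ (+-identityʳ _)) ⟩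
    x 3 + (x 2 + wtσ 1 * wtσ 2)        ≈⟨ x∙yz≈yx∙z _ _ _ ⟩
    (x 2 + x 3) + wtσ 1 * wtσ 2        ≈⟨ +-congˡ (*-congʳ (+-identityˡ _)) ⟨
    (x 2 + x 3) + (0# + wtσ 1) * wtσ 2 ∎
  innerCodes-value (suc r) = begin
    x (4 ℕ.+ r) + sumOver value (innerCodes r ++ via-side (3 ℕ.+ r) ∷ τs)
      ≈⟨ +-congˡ (sumOver-++ value (innerCodes r) _) ⟩
    x (4 ℕ.+ r) + (sumOver value (innerCodes r) + (x (3 ℕ.+ r) + sumOver value τs))
      ≈⟨ +-congˡ (+-congˡ (+-congˡ τs-value)) ⟩
    x (4 ℕ.+ r) + (sumOver value (innerCodes r) + (x (3 ℕ.+ r) + W (suc r) * wtσ (3 ℕ.+ r)))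
      ≈⟨ +-congˡ (x∙yz≈yx∙z _ _ _) ⟩
    x (4 ℕ.+ r) + ((x (3 ℕ.+ r) + sumOver value (innerCodes r)) + W (suc r) * wtσ (3 ℕ.+ r))
      ≈⟨ +-congˡ (+-congʳ (innerCodes-value r)) ⟩
    x (4 ℕ.+ r) + (Y (suc r) + W (suc r) * wtσ (3 ℕ.+ r))
      ≈⟨ x∙yz≈yx∙z _ _ _ ⟩
    (Y (suc r) + x (4 ℕ.+ r)) + W (suc r) * wtσ (3 ℕ.+ r) ∎
    where
      τs : List Code
      τs = map (λ i → via-τ i (3 ℕ.+ r)) (range 1 (2 ℕ.+ r))
      τs-value : sumOver value τs ≈ W (suc r) * wtσ (3 ℕ.+ r)
      τs-value = begin
        sumOver value τs                                       ≡⟨ sumOver-map value _ (range 1 (2 ℕ.+ r)) ⟩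
        sumOver (λ i → wtσ i * wtσ (3 ℕ.+ r)) (range 1 (2 ℕ.+ r)) ≈⟨ sumOver-*ʳ wtσ _ (range 1 (2 ℕ.+ r)) ⟩
        sumOver wtσ (range 1 (2 ℕ.+ r)) * wtσ (3 ℕ.+ r)          ≈⟨ *-congʳ (sumOver-range wtσ (2 ℕ.+ r)) ⟩
        W (suc r) * wtσ (3 ℕ.+ r)                              ∎

  fraction-normal : ∀ {a b c d e} → Pos b → Pos c → Pos d → Pos e →
                    (a * e) * (c * inv (b * d)) ≈ a * (inv b * (c * (inv d * e)))
  fraction-normal {a} {b} {c} {d} {e} pb pc pd pe = begin
    (a * e) * (c * inv (b * d))          ≈⟨ *-congˡ (*-congˡ (inv-* pb pd)) ⟩
    (a * e) * (c * (inv b * inv d))      ≈⟨ *-assoc _ _ _ ⟩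
    a * (e * (c * (inv b * inv d)))      ≈⟨ *-congˡ (*-exchange-even (Pos⇒Even pc) _ _) ⟩
    a * (c * (e * (inv b * inv d)))      ≈⟨ *-congˡ (*-congˡ (*-exchange-even (Pos⇒Even (Pos-inv pb)) _ _)) ⟩
    a * (c * (inv b * (e * inv d)))      ≈⟨ *-congˡ (*-congˡ (*-congˡ (Pos-central pe _))) ⟩
    a * (c * (inv b * (inv d * e)))      ≈⟨ *-congˡ (*-exchange-even (Pos⇒Even (Pos-inv pb)) _ _) ⟩
    a * (inv b * (c * (inv d * e)))      ∎

  prodTo-ones : ∀ m → prodTo m (λ _ → 1#) ≈ 1#
  prodTo-ones m = prodTo-flat (λ _ → 1#) {m = m} z≤n (λ _ _ _ → refl)

  module _ (r : ℕ) (k≤n : 4 ℕ.+ r ≤ n) where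
    open FanPaths r using (k; decode; superTPaths↭decoded)

    q : Carrier
    q = l1 2 * l1 k

    l1-pos : ∀ {j} → 2 ≤ j → j ≤ k → Pos (l1 j)
    l1-pos 2≤j j≤k = pl1 _ 2≤j (≤-trans j≤k k≤n)

    without-σ : ∀ w → w * prodTo (2 ℕ.+ r) (λ _ → 1#) ≈ w
    without-σ w = trans (*-congˡ (prodTo-ones (2 ℕ.+ r))) (*-identityʳ w)

    p2 : Pos (l1 2)
    p2 = l1-pos ≤-refl (s≤s (s≤s z≤n))
    pk : Pos (l1 k)
    pk = l1-pos (s≤s (s≤s z≤n)) ≤-refl

    weight-via-23 : wtPath k (decode via-23) ≈ q * x 2
    weight-via-23 = begin
      (ls 2 * (inv (l1 3) * (l1 k * 1#))) * prodTo (2 ℕ.+ r) (λ _ → 1#) ≈⟨ without-σ _ ⟩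
      ls 2 * (inv (l1 3) * (l1 k * 1#))                                ≈⟨ *-congˡ (*-congˡ (*-identityʳ _)) ⟩
      ls 2 * (inv (l1 3) * l1 k)                                       ≈⟨ inv-cancelˡ p2 _ ⟨
      l1 2 * (inv (l1 2) * (ls 2 * (inv (l1 3) * l1 k)))               ≈⟨ fraction-normal p2 pls2 p3 pk ⟨
      q * x 2                                                          ∎
      where
        p3 : Pos (l1 3)
        p3 = l1-pos (s≤s (s≤s z≤n)) (s≤s (s≤s (s≤s z≤n)))
        pls2 : Pos (ls 2)
        pls2 = pls 2 ≤-refl (≤-trans (s≤s (s≤s (s≤s z≤n))) k≤n)

    weight-via-end : wtPath k (decode (via-end (3 ℕ.+ r))) ≈ q * x (3 ℕ.+ r)
    weight-via-end = begin
      (l1 2 * (inv (l1 (3 ℕ.+ r)) * (ls (3 ℕ.+ r) * 1#))) * prodTo (2 ℕ.+ r) (λ _ → 1#) ≈⟨ without-σ _ ⟩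
      l1 2 * (inv (l1 (3 ℕ.+ r)) * (ls (3 ℕ.+ r) * 1#))          ≈⟨ *-congˡ (*-congˡ (*-congˡ (inv-inverseˡ pk))) ⟨
      l1 2 * (inv (l1 (3 ℕ.+ r)) * (ls (3 ℕ.+ r) * (inv (l1 k) * l1 k))) ≈⟨ fraction-normal pj pls-j pk pk ⟨
      q * x (3 ℕ.+ r)                                            ∎
      where
        pj : Pos (l1 (3 ℕ.+ r))
        pj = l1-pos (s≤s (s≤s z≤n)) (n≤1+n _)
        pls-j : Pos (ls (3 ℕ.+ r))
        pls-j = pls (3 ℕ.+ r) (s≤s (s≤s z≤n)) k≤n

    weight-via-side : ∀ {j} → 3 ≤ j → j ≤ 2 ℕ.+ r → wtPath k (decode (via-side j)) ≈ q * x j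
    weight-via-side {j@(suc (suc (suc t)))} (s≤s (s≤s (s≤s z≤n))) j≤ = begin
      (l1 2 * (inv (l1 j) * (ls j * (inv (l1 (suc j)) * (l1 k * 1#))))) * prodTo (2 ℕ.+ r) (λ _ → 1#) ≈⟨ without-σ _ ⟩
      l1 2 * (inv (l1 j) * (ls j * (inv (l1 (suc j)) * (l1 k * 1#)))) ≈⟨ *-congˡ (*-congˡ (*-congˡ (*-congˡ (*-identityʳ _)))) ⟩
      l1 2 * (inv (l1 j) * (ls j * (inv (l1 (suc j)) * l1 k)))        ≈⟨ fraction-normal pj pls-j pj+1 pk ⟨
      q * x j                                                         ∎
      where
        j+1≤k : suc j ≤ k
        j+1≤k = s≤s (≤-trans j≤ (n≤1+n _))
        pj : Pos (l1 j)
        pj = l1-pos (s≤s (s≤s z≤n)) (≤-trans (n≤1+n _) j+1≤k)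
        pj+1 : Pos (l1 (suc j))
        pj+1 = l1-pos (s≤s (s≤s z≤n)) j+1≤k
        pls-j : Pos (ls j)
        pls-j = pls j (s≤s (s≤s z≤n)) (≤-trans j+1≤k k≤n)

    weight-via-τ : ∀ {i y} → 1 ≤ i → i < y → y ≤ 2 ℕ.+ r → wtPath k (decode (via-τ i y)) ≈ q * (wtσ i * wtσ y)
    weight-via-τ {i} {y} 1≤i i<y y≤ =
      *-cong (*-congˡ (*-identityʳ _))
             (trans (prodTo-pair selected 1≤i i<y y≤ not-selected) (*-cong selected-i selected-y))
      where
        selected : ℕ → Carrier
        selected z = if (z ≡ᵇ i) ∨ ((z ≡ᵇ y) ∨ false) then wtσ z else 1#
        not-selected : ∀ z → z ≢ i → z ≢ y → selected z ≈ 1#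
        not-selected z z≢i z≢y with z ≡ᵇ i in z=i | z ≡ᵇ y in z=y
        ... | true  | _     = contradiction (≡ᵇ⇒≡ z i (≡true⇒T z=i)) z≢i
        ... | false | true  = contradiction (≡ᵇ⇒≡ z y (≡true⇒T z=y)) z≢y
        ... | false | false = refl
        selected-i : selected i ≈ wtσ i
        selected-i rewrite T⇒≡true (≡⇒≡ᵇ i i ≡.refl) = refl
        selected-y : selected y ≈ wtσ y
        selected-y with y ≡ᵇ i in y=i
        ... | true  = contradiction (≡ᵇ⇒≡ y i (≡true⇒T y=i)) (<⇒≢ i<y ∘ ≡.sym)
        ... | false rewrite T⇒≡true (≡⇒≡ᵇ y y ≡.refl) = refl

    weight-decode : ∀ {c} → ValidCode r c → wtPath k (decode c) ≈ q * value c
    weight-decode via-end                    = weight-via-end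
    weight-decode (inner via-23)             = weight-via-23
    weight-decode (inner (via-side 3≤j j≤))  = weight-via-side 3≤j j≤
    weight-decode (inner (via-τ 1≤i i<y y≤)) = weight-via-τ 1≤i i<y y≤

    sumT≈qY : sumT k ≈ q * Y (suc r)
    sumT≈qY = begin
      sumOver (wtPath k) (superTPaths k)               ≈⟨ sumOver-↭ (wtPath k) superTPaths↭decoded ⟩
      sumOver (wtPath k) (map decode (codes r))        ≡⟨ sumOver-map (wtPath k) decode (codes r) ⟩
      sumOver (λ c → wtPath k (decode c)) (codes r)   ≈⟨ sumOver-cong (codes r) (weight-decode ∘ ∈-codes⁻ r) ⟩
      sumOver (λ c → q * value c) (codes r)            ≈⟨ sumOver-*ˡ q value (codes r) ⟩
      q * sumOver value (codes r)                      ≈⟨ *-congˡ (innerCodes-value r) ⟩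
      q * Y (suc r)                                    ∎

  sumT-triangle : sumT 3 ≈ ls 2
  sumT-triangle = begin
    (ls 2 * 1#) * (1# * 1#) + 0# ≈⟨ +-identityʳ _ ⟩
    (ls 2 * 1#) * (1# * 1#)      ≈⟨ *-cong (*-identityʳ _) (*-identityʳ _) ⟩
    ls 2 * 1#                    ≈⟨ *-identityʳ _ ⟩
    ls 2                         ∎

  λ₂ₖ≈sumT : ∀ m → 3 ℕ.+ m ≤ n → lam2 (3 ℕ.+ m) ≈ sumT (3 ℕ.+ m)
  λ₂ₖ≈sumT zero    _   = sym sumT-triangle
  λ₂ₖ≈sumT (suc r) k≤n = trans (FanInvariant.L≈deY (state-invariant (suc r) k≤n)) (sym (sumT≈qY r k≤n))

theorem6p4 : ∀ {c ℓ : Level} (S : SuperAlgebra c ℓ) →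
    let open SuperAlgebra S in
    (n : ℕ) → 3 ≤ n →
    (l1 ls th : ℕ → Carrier) →
    (∀ j → 2 ≤ j → j ≤ n → Pos (l1 j)) →
    (∀ j → 2 ≤ j → suc j ≤ n → Pos (ls j)) →
    (∀ i → 1 ≤ i → suc (suc i) ≤ n → Odd (th i)) →
    (k : ℕ) → 3 ≤ k → k ≤ n →
    let open Fan S l1 ls th in
      (sqrt (lam2 k * inv (l1 2 * l1 k)) * box12 k ≈ sumTo (k ∸ 2) wtσ)
    × (lam2 k ≈ sumT k)
theorem6p4 S n _ l1 ls th pl1 pls oth _ (s≤s (s≤s (s≤s {n = m} _))) k≤n =
  FanInvariant.scaled-M (state-invariant m k≤n) , λ₂ₖ≈sumT m k≤n
  where
    open PtolemyFlip S using (FanInvariant)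
    open FlipSequence S n l1 ls th pl1 pls oth using (state-invariant)
    open PathWeights S n l1 ls th pl1 pls oth using (λ₂ₖ≈sumT)
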